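{- Let $\phi$ and $\chi$ be Datalog$^\cup$ reductions such that the output signature of $\phi$ coincides with the input signature of $\chi$. Then there is a Datalog$^\cup$ reduction $\psi$ such that $\psi(\mathbf A)$ and $\chi(\phi(\mathbf A))$ are isomorphic for all structures $\mathbf A$ (of the input signature of $\phi$).
   Context: Signatures and structures: a (multisorted relational) signature consists of a set of types and a set of relational symbols; each symbol $R$ has an arity $\mathrm{ar}_R=(\mathrm{ar}_R(1),\dots,\mathrm{ar}_R(k))$, a tuple of types. A structure $\mathbf A$ consists of a set $A_t$ for every type $t$ (elements of different types are distinct) and a relation $R^{\mathbf A}\subseteq A_{\mathrm{ar}_R(1)}\times\dots\times A_{\mathrm{ar}_R(k)}$ for every symbol $R$. Datalog: variables are typed. An atomic formula over a signature $\Delta$ is either $R(x_1,\dots,x_k)$ with $R$ a $\Delta$-symbol and $x_i$ of type $\mathrm{ar}_R(i)$, or $x=y$ with $x,y$ of the same type. A Datalog program with input signature $\Pi$ consists of a signature $\Delta\supseteq\Pi$ with the same types as $\Pi$, a finite set of rules $t_0\leftarrow t_1,\dots,t_r$ (atomic $\Delta$-formulas; the head $t_0$ uses neither a $\Pi$-symbol nor equality), and a designated output symbol. On a $\Pi$-structure $\mathbf A$ it computes the least $\Delta$-expansion of $\mathbf A$ closed under the rules (standard fixed-point semantics, starting with non-input relations empty); the output is the resulting relation of the output symbol. Its width is the maximal number of variables in a rule. Datalog interpretation $\phi$ from $\Pi$-structures to $\Sigma$-structures: a Datalog program $\phi_t$ (input signature $\Pi$) for each $\Sigma$-type $t$ and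 $\phi_R$ for each $\Sigma$-symbol $R$, where the arity of $\phi_R$ is the concatenation of the arities of $\phi_{\mathrm{ar}_R(1)},\dots,\phi_{\mathrm{ar}_R(k)}$. Then $\phi(\mathbf A)$ has domain $\phi_t(\mathbf A)$ for type $t$, and $R^{\phi(\mathbf A)}$ is the set of $(w_1,\dots,w_k)\in\prod_i\phi_{\mathrm{ar}_R(i)}(\mathbf A)$ whose concatenation lies in $\phi_R(\mathbf A)$. Union gadget from $\Pi$ to $\Sigma$: a pair $(d,r)$ with $d$ mapping $\Pi$-types to $\Sigma$-types and $r$ mapping $\Pi$-symbols to $\Sigma$-symbols so that $\mathrm{ar}_{r(R)}=d\circ\mathrm{ar}_R$. Applied to a $\Pi$-structure $\mathbf A$ (with pairwise disjoint domains) it yields the $\Sigma$-structure $\upsilon(\mathbf A)$ whose domain of type $t$ is $\bigcup_{d(i)=t}A_i$ and with $S^{\upsilon(\mathbf A)}=\bigcup_{r(R)=S}R^{\mathbf A}$. A Datalog$^\cup$ reduction is a composition $\upsilon\circ\phi$ of a Datalog interpretation $\phi$ followed by a union gadget $\upsilon$ (its input signature is that of $\phi$, its output signature that of $\upsilon$). -}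

module Defs where

open import Data.Nat using (ℕ)
open import Data.Fin using (Fin)
open import Data.List as List using (List; []; _∷_; _++_)
open import Data.List.Membership.Propositional using (_∈_)
open import Data.List.Relation.Unary.All as All using (All; []; _∷_)
open import Data.Product using (Σ; Σ-syntax; _×_; _,_; proj₁)
open import Data.Sum using (_⊎_; inj₁; inj₂)
open import Data.Unit using (⊤)
open import Relation.Binary.PropositionalEquality using (_≡_; subst; sym)
open import Function.Bundles using (_⇔_)

record Signature : Set where
  field
    nTy  : ℕ
    nSym : ℕ
    ar   : Fin nSym → List (Fin nTy)
open Signature public

_++ᵗ_ : ∀ {T : Set} {U : T → Set} {xs ys : List T} →
        All U xs → All U ys → All U (xs ++ ys)
[] ++ᵗ ys = ys
(x ∷ xs) ++ᵗ ys = x ∷ (xs ++ᵗ ys)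

cmap : {A B : Set} → (A → List B) → List A → List B
cmap f [] = []
cmap f (x ∷ xs) = f x ++ cmap f xs

flatten : ∀ {T S : Set} {U : T → Set} {a : S → List T} {ss : List S} →
          All (λ s → All U (a s)) ss → All U (cmap a ss)
flatten [] = []
flatten (w ∷ ws) = w ++ᵗ flatten ws

Every : ∀ {T : Set} {U : T → Set} (D : (t : T) → U t → Set) {ts : List T} →
        All U ts → Set
Every D {[]} [] = ⊤
Every D {t ∷ ts} (x ∷ xs) = D t x × Every D xs

toList : ∀ {T X : Set} {ts : List T} → All (λ _ → X) ts → List X
toList [] = []
toList (x ∷ xs) = x ∷ toList xs

tag : ∀ {T : Set} {U : T → Set} {ts : List T} → All U ts → List (Σ T U)
tag {ts = []} [] = []
tag {ts = t ∷ ts} (x ∷ xs) = (t , x) ∷ tag xs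

-- The domain of type t is the subset {x : U t | D t x} of a
-- carrier U t (equality of elements is _≡_ on U t).

record Structure (P : Signature) : Set₁ where
  field
    U      : Fin (nTy P) → Set
    D      : (t : Fin (nTy P)) → U t → Set
    rel    : (R : Fin (nSym P)) → All U (ar P R) → Set
    relDom : (R : Fin (nSym P)) (xs : All U (ar P R)) → rel R xs → Every D xs
open Structure public

record Iso {S : Signature} (A B : Structure S) : Set where
  field
    f       : (t : Fin (nTy S)) → U A t → U B t
    presD   : ∀ t x → D A t x → D B t (f t x)
    inj     : ∀ t x y → D A t x → D A t y → f t x ≡ f t y → x ≡ y
    surj    : ∀ t y → D B t y → Σ[ x ∈ U A t ] (D A t x × f t x ≡ y)
    presRel : ∀ R (xs : All (U A) (ar S R)) → Every (D A) xs →
              rel A R xs ⇔ rel B R (All.map (λ {t} → f t) xs)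

-- Datalog programs with input signature P.  The signature Δ consists of
-- the P-symbols (inj₁) plus nIdb new symbols (inj₂) with arities idbAr;
-- Δ has the same types as P.

Δar : (P : Signature) (nI : ℕ) (idbAr : Fin nI → List (Fin (nTy P))) →
      Fin (nSym P) ⊎ Fin nI → List (Fin (nTy P))
Δar P nI idbAr (inj₁ R) = ar P R
Δar P nI idbAr (inj₂ i) = idbAr i

data Atom (P : Signature) (nI : ℕ) (idbAr : Fin nI → List (Fin (nTy P)))
          (Γ : List (Fin (nTy P))) : Set where
  relA : (s : Fin (nSym P) ⊎ Fin nI) → All (_∈ Γ) (Δar P nI idbAr s) →
         Atom P nI idbAr Γ
  eqA  : ∀ {t} → t ∈ Γ → t ∈ Γ → Atom P nI idbAr Γ

record Rule (P : Signature) (nI : ℕ) (idbAr : Fin nI → List (Fin (nTy P))) : Set where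
  field
    vars     : List (Fin (nTy P))
    head     : Fin nI
    headArgs : All (_∈ vars) (idbAr head)
    body     : List (Atom P nI idbAr vars)

record Program (P : Signature) : Set where
  field
    nIdb  : ℕ
    idbAr : Fin nIdb → List (Fin (nTy P))
    rules : List (Rule P nIdb idbAr)
    out   : Fin (nSym P) ⊎ Fin nIdb

  outAr : List (Fin (nTy P))
  outAr = Δar P nIdb idbAr out

-- Least fixed-point semantics: Fact s xs holds iff xs belongs to the
-- relation of s in the least Δ-expansion of A closed under the rules.
module Sem {P : Signature} (prog : Program P) (A : Structure P) where
  open Program prog

  data Fact : (s : Fin (nSym P) ⊎ Fin nIdb) → All (U A) (Δar P nIdb idbAr s) → Set
  Holds : ∀ {Γ} → All (U A) Γ → Atom P nIdb idbAr Γ → Set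

  data Fact where
    inp : ∀ {R} {xs : All (U A) (ar P R)} → rel A R xs → Fact (inj₁ R) xs
    der : (r : Rule P nIdb idbAr) → r ∈ rules →
          (ν : All (U A) (Rule.vars r)) → Every (D A) ν →
          All (Holds ν) (Rule.body r) →
          Fact (inj₂ (Rule.head r)) (All.map (All.lookup ν) (Rule.headArgs r))

  Holds ν (relA s xs) = Fact s (All.map (All.lookup ν) xs)
  Holds ν (eqA x y)   = All.lookup ν x ≡ All.lookup ν y

  Output : All (U A) outAr → Set
  Output = Fact out

record Interp (P S : Signature) : Set where
  field
    progT : Fin (nTy S) → Program P
    progR : Fin (nSym S) → Program P
    arOK  : ∀ R → Program.outAr (progR R) ≡
                  cmap (λ s → Program.outAr (progT s)) (ar S R)

applyI : {P S : Signature} → Interp P S → Structure P → Structure S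
applyI {P} {S} φ A = record
  { U = UI ; D = DI ; rel = relI ; relDom = λ R ws → proj₁ }
  where
  open Interp φ
  UI : Fin (nTy S) → Set
  UI t = All (U A) (Program.outAr (progT t))
  DI : (t : Fin (nTy S)) → UI t → Set
  DI t w = Sem.Output (progT t) A w
  relI : (R : Fin (nSym S)) → All UI (ar S R) → Set
  relI R ws = Every DI ws ×
              Sem.Output (progR R) A
                (subst (All (U A)) (sym (arOK R)) (flatten ws))

-- Union gadgets from P to S.  The domain of type t of the result is the
-- disjoint union of the domains A_i with d i ≡ t (elements tagged by i).

record Gadget (P S : Signature) : Set where
  field
    d    : Fin (nTy P) → Fin (nTy S)
    r    : Fin (nSym P) → Fin (nSym S)
    arOK : ∀ R → ar S (r R) ≡ List.map d (ar P R)

applyG : {P S : Signature} → Gadget P S → Structure P → Structure S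
applyG {P} {S} υ A = record
  { U = UG ; D = DG ; rel = relG ; relDom = λ R ws → proj₁ }
  where
  open Gadget υ
  UG : Fin (nTy S) → Set
  UG _ = Σ (Fin (nTy P)) (U A)
  DG : (t : Fin (nTy S)) → UG t → Set
  DG t (i , x) = d i ≡ t × D A i x
  relG : (Sy : Fin (nSym S)) → All UG (ar S Sy) → Set
  relG Sy ws = Every DG ws ×
               Σ[ R ∈ Fin (nSym P) ] (r R ≡ Sy ×
               Σ[ xs ∈ All (U A) (ar P R) ] (rel A R xs × toList ws ≡ tag xs))

record Reduction (P S : Signature) : Set where
  field
    mid    : Signature
    interp : Interp P mid
    gadget : Gadget mid S

applyR : {P S : Signature} → Reduction P S → Structure P → Structure S
applyR ρ A = applyG (Reduction.gadget ρ) (applyI (Reduction.interp ρ) A)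

module Submission where

-- Write φ = υ₁ ∘ φI and χ = υ₂ ∘ χI.  An element of υ₁(φI(A)) is a pair (i , w) of a type i of the
-- intermediate signature and a tuple w of A, so a tuple of such elements is determined by the list of
-- the i's (a "choice", ranging over a finite set) and the concatenation of the w's.  Hence a Datalog
-- program Q on υ₁(φI(A)) can be simulated on A: for each symbol of Q and each choice there is an IDB
-- holding the concatenated tuples, and each rule of Q is copied once for every admissible choice of
-- its variables; the domains and relations of φI(A) it consults are themselves defined by the
-- programs of φI, which are inlined.  Simulating the programs of χI this way gives an interpretation
-- whose types and symbols are those of χI paired with choices; followed by υ₂ (which forgets the
-- choices) it is the required reduction ψ, and (j , κ , w) ↦ (j , unflatten κ w) is an isomorphism
-- from ψ(A) onto χ(φ(A)).

open import Defs
open import Data.Nat using (ℕ; zero; suc; _+_)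
open import Data.Fin using (Fin; zero; suc; splitAt; join; _≟_)
open import Data.Fin.Properties using (splitAt-join; join-splitAt)
open import Data.List as List using (List; []; _∷_; _++_; allFin)
open import Data.List.Properties using (∷-injective; ++-assoc; ≡-dec; map-injective)
open import Data.List.Membership.Propositional using (_∈_)
open import Data.List.Membership.Propositional.Properties using (∈-allFin; ∈-map⁺; ∈-++⁺ˡ; ∈-++⁺ʳ)
open import Data.List.Relation.Unary.Any using (here; there)
open import Data.List.Relation.Unary.All as All using (All; []; _∷_)
open import Data.List.Relation.Unary.All.Properties using (++⁺; ++⁻; map⁺; map⁻)
open import Data.Product using (Σ; Σ-syntax; _×_; _,_; proj₁; proj₂)
open import Data.Product.Properties using (Σ-≡,≡→≡)
open import Data.Product.Properties.WithK using (,-injectiveʳ)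
open import Data.Sum as Sum using (_⊎_; inj₁; inj₂)
open import Data.Unit using (⊤; tt)
open import Data.Empty using (⊥; ⊥-elim)
open import Relation.Nullary using (Dec; yes; no)
open import Relation.Nullary.Decidable using (_×-dec_)
open import Relation.Binary.PropositionalEquality
open import Relation.Binary.PropositionalEquality.Properties
  using (dcong₂; subst-application′; subst-subst-sym; subst-sym-subst; subst-∘)
open import Axiom.UniquenessOfIdentityProofs.WithK using (uip)
open import Function.Base using (id)
open import Function.Bundles using (_⇔_; mk⇔; Equivalence)
open import Function.Construct.Composition using (_⇔-∘_)

-- Finite types

record Finite (X : Set) : Set where
  field
    size          : ℕ
    encode        : X → Fin size
    decode        : Fin size → X
    decode-encode : ∀ x → decode (encode x) ≡ x
    encode-decode : ∀ c → encode (decode c) ≡ c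
open Finite public

Finite-via : {X Y : Set} → Finite X → (f : X → Y) (g : Y → X) →
             (∀ y → f (g y) ≡ y) → (∀ x → g (f x) ≡ x) → Finite Y
Finite-via F f g fg gf = record
  { size = size F
  ; encode = λ y → encode F (g y)
  ; decode = λ c → f (decode F c)
  ; decode-encode = λ y → trans (cong f (decode-encode F (g y))) (fg y)
  ; encode-decode = λ c → trans (cong (encode F) (gf (decode F c))) (encode-decode F c) }

Finite-Fin : (n : ℕ) → Finite (Fin n)
Finite-Fin n = record
  { size = n ; encode = λ x → x ; decode = λ x → x
  ; decode-encode = λ _ → refl ; encode-decode = λ _ → refl }

Finite-⊥ : Finite ⊥
Finite-⊥ = record
  { size = 0 ; encode = λ () ; decode = λ () ; decode-encode = λ () ; encode-decode = λ () }

Finite-⊤ : Finite ⊤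
Finite-⊤ = record
  { size = 1 ; encode = λ _ → zero ; decode = λ _ → tt
  ; decode-encode = λ _ → refl ; encode-decode = λ { zero → refl } }

Finite-⊎ : {X Y : Set} → Finite X → Finite Y → Finite (X ⊎ Y)
Finite-⊎ F G = record
  { size = size F + size G
  ; encode = λ z → join (size F) (size G) (Sum.map (encode F) (encode G) z)
  ; decode = λ c → Sum.map (decode F) (decode G) (splitAt (size F) c)
  ; decode-encode = λ z →
      trans (cong (Sum.map (decode F) (decode G))
                   (splitAt-join (size F) (size G) (Sum.map (encode F) (encode G) z)))
            (dec-enc z)
  ; encode-decode = λ c →
      trans (cong (join (size F) (size G)) (enc-dec (splitAt (size F) c))) (join-splitAt (size F) (size G) c) }
  where
  dec-enc : ∀ z → Sum.map (decode F) (decode G) (Sum.map (encode F) (encode G) z) ≡ z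
  dec-enc (inj₁ x) = cong inj₁ (decode-encode F x)
  dec-enc (inj₂ y) = cong inj₂ (decode-encode G y)
  enc-dec : ∀ z → Sum.map (encode F) (encode G) (Sum.map (decode F) (decode G) z) ≡ z
  enc-dec (inj₁ x) = cong inj₁ (encode-decode F x)
  enc-dec (inj₂ y) = cong inj₂ (encode-decode G y)

Finite-ΣFin : (n : ℕ) (F : Fin n → Set) → (∀ i → Finite (F i)) → Finite (Σ (Fin n) F)
Finite-ΣFin zero F FF = Finite-via Finite-⊥ (λ ()) (λ { (() , _) }) (λ { (() , _) }) (λ ())
Finite-ΣFin (suc n) F FF =
  Finite-via (Finite-⊎ (FF zero) (Finite-ΣFin n (λ i → F (suc i)) (λ i → FF (suc i)))) to from to-from from-to
  where
  to : F zero ⊎ Σ (Fin n) (λ i → F (suc i)) → Σ (Fin (suc n)) F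
  to (inj₁ y) = zero , y
  to (inj₂ (i , y)) = suc i , y
  from : Σ (Fin (suc n)) F → F zero ⊎ Σ (Fin n) (λ i → F (suc i))
  from (zero , y) = inj₁ y
  from (suc i , y) = inj₂ (i , y)
  to-from : ∀ y → to (from y) ≡ y
  to-from (zero , y) = refl
  to-from (suc i , y) = refl
  from-to : ∀ x → from (to x) ≡ x
  from-to (inj₁ y) = refl
  from-to (inj₂ (i , y)) = refl

Finite-Σ : {X : Set} {G : X → Set} → Finite X → (∀ x → Finite (G x)) → Finite (Σ X G)
Finite-Σ {X} {G} F GF =
  Finite-via (Finite-ΣFin (size F) (λ c → G (decode F c)) (λ c → GF (decode F c))) to from to-from from-to
  where
  to : Σ (Fin (size F)) (λ c → G (decode F c)) → Σ X G
  to (c , y) = decode F c , y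
  from : Σ X G → Σ (Fin (size F)) (λ c → G (decode F c))
  from (x , y) = encode F x , subst G (sym (decode-encode F x)) y
  to-from : ∀ y → to (from y) ≡ y
  to-from (x , y) = Σ-≡,≡→≡ (decode-encode F x , subst-subst-sym (decode-encode F x))
  subst-loop : {a b : X} (q : a ≡ b) (p : b ≡ a) {y : G a} → subst G p (subst G q y) ≡ y
  subst-loop refl p rewrite uip p refl = refl
  from-to : ∀ x → from (to x) ≡ x
  from-to (c , y) = Σ-≡,≡→≡ (encode-decode F c ,
    trans (subst-∘ {P = G} {f = decode F} (encode-decode F c))
          (subst-loop (sym (decode-encode F (decode F c))) (cong (decode F) (encode-decode F c))))

Finite-× : {X Y : Set} → Finite X → Finite Y → Finite (X × Y)
Finite-× F G = Finite-Σ F (λ _ → G)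

Finite-All : {T : Set} (F : T → Set) → (∀ t → Finite (F t)) → (ts : List T) → Finite (All F ts)
Finite-All F FF [] = Finite-via Finite-⊤ (λ _ → []) (λ _ → tt) (λ { [] → refl }) (λ _ → refl)
Finite-All F FF (t ∷ ts) =
  Finite-via (Finite-× (FF t) (Finite-All F FF ts)) (λ (y , ys) → y ∷ ys) (λ { (y ∷ ys) → y , ys })
    (λ { (y ∷ ys) → refl }) (λ _ → refl)

decode-injective : {X : Set} (F : Finite X) {c c′ : Fin (size F)} → decode F c ≡ decode F c′ → c ≡ c′
decode-injective F {c} {c′} e = trans (sym (encode-decode F c)) (trans (cong (encode F) e) (encode-decode F c′))

enumerate : {X : Set} → Finite X → List X
enumerate F = List.map (decode F) (allFin (size F))

∈-enumerate : {X : Set} (F : Finite X) (x : X) → x ∈ enumerate F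
∈-enumerate F x = subst (_∈ enumerate F) (decode-encode F x) (∈-map⁺ (decode F) (∈-allFin (encode F x)))

-- Lists and tuples

∈-cmap : {A B : Set} {f : A → List B} {x : A} {y : B} (xs : List A) →
         x ∈ xs → y ∈ f x → y ∈ cmap f xs
∈-cmap (x ∷ xs) (here refl) m = ∈-++⁺ˡ m
∈-cmap {f = f} (x ∷ xs) (there p) m = ∈-++⁺ʳ (f x) (∈-cmap xs p m)

All-cmap⁺ : {A B : Set} {P : B → Set} {f : A → List B} (xs : List A) →
            (∀ x → x ∈ xs → All P (f x)) → All P (cmap f xs)
All-cmap⁺ [] h = []
All-cmap⁺ (x ∷ xs) h = ++⁺ (h x (here refl)) (All-cmap⁺ xs (λ y m → h y (there m)))

cmap-++ : {A B : Set} (f : A → List B) (xs ys : List A) → cmap f (xs ++ ys) ≡ cmap f xs ++ cmap f ys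
cmap-++ f [] ys = refl
cmap-++ f (x ∷ xs) ys = trans (cong (f x ++_) (cmap-++ f xs ys)) (sym (++-assoc (f x) (cmap f xs) (cmap f ys)))

whenDec : {X B : Set} → Dec X → (X → List B) → List B
whenDec (yes x) f = f x
whenDec (no _) f = []

∈-whenDec : {X B : Set} (d : Dec X) (f : X → List B) → (∀ (a b : X) → a ≡ b) →
            (x : X) {y : B} → y ∈ f x → y ∈ whenDec d f
∈-whenDec (yes x') f irr x m = subst (λ z → _ ∈ f z) (irr x x') m
∈-whenDec (no ¬x) f irr x m = ⊥-elim (¬x x)

∈-whenDec-const : {X B : Set} (d : Dec X) (l : List B) → X → {y : B} → y ∈ l → y ∈ whenDec d (λ _ → l)
∈-whenDec-const (yes _) l x m = m
∈-whenDec-const (no ¬x) l x m = ⊥-elim (¬x x)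

All-whenDec : {X B : Set} {P : B → Set} (d : Dec X) (f : X → List B) → (∀ x → All P (f x)) → All P (whenDec d f)
All-whenDec (yes x) f h = h x
All-whenDec (no _) f h = []

concatMapᵗ : {J X : Set} {V : J → Set} → (∀ {j} → V j → List X) → {js : List J} → All V js → List X
concatMapᵗ g [] = []
concatMapᵗ g (v ∷ vs) = g v ++ concatMapᵗ g vs

allPositions : {T : Set} (l : List T) → All (_∈ l) l
allPositions [] = []
allPositions (x ∷ l) = here refl ∷ All.map there (allPositions l)

module _ {T : Set} {U : T → Set} where

  All-∷-injective : {t : T} {l : List T} {x y : U t} {xs ys : All U l} →
                    _≡_ {A = All U (t ∷ l)} (x ∷ xs) (y ∷ ys) → x ≡ y × xs ≡ ys
  All-∷-injective refl = refl , refl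

  ++⁻-++ᵗ : {xs ys : List T} (a : All U xs) (b : All U ys) → ++⁻ xs (a ++ᵗ b) ≡ (a , b)
  ++⁻-++ᵗ [] b = refl
  ++⁻-++ᵗ (u ∷ a) b rewrite ++⁻-++ᵗ a b = refl

  ++ᵗ-++⁻ : (xs : List T) {ys : List T} (w : All U (xs ++ ys)) →
            proj₁ (++⁻ xs w) ++ᵗ proj₂ (++⁻ xs w) ≡ w
  ++ᵗ-++⁻ [] w = refl
  ++ᵗ-++⁻ (x ∷ xs) (u ∷ w) = cong (u ∷_) (++ᵗ-++⁻ xs w)

  tag-subst : {X : Set} (h : X → List T) {y x : X} (e : y ≡ x) (a : All U (h y)) →
              tag (subst (λ z → All U (h z)) e a) ≡ tag a
  tag-subst h refl a = refl

  tag-++ᵗ : {xs ys : List T} (a : All U xs) (b : All U ys) → tag (a ++ᵗ b) ≡ tag a ++ tag b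
  tag-++ᵗ [] b = refl
  tag-++ᵗ (u ∷ a) b = cong ((_ , u) ∷_) (tag-++ᵗ a b)

  tag-injective : {xs : List T} (a b : All U xs) → tag a ≡ tag b → a ≡ b
  tag-injective [] [] e = refl
  tag-injective (u ∷ a) (v ∷ b) e =
    cong₂ _∷_ (,-injectiveʳ (proj₁ (∷-injective e))) (tag-injective a b (proj₂ (∷-injective e)))

  tag-cancelˡ : {l : List T} (p p' : All U l) {X Y : List (Σ T U)} →
                tag p ++ X ≡ tag p' ++ Y → p ≡ p' × X ≡ Y
  tag-cancelˡ [] [] e = refl , e
  tag-cancelˡ (u ∷ p) (v ∷ p') e with tag-cancelˡ p p' (proj₂ (∷-injective e))
  ... | p≡p' , X≡Y = cong₂ _∷_ (,-injectiveʳ (proj₁ (∷-injective e))) p≡p' , X≡Y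

  module _ {S : Set} {a : S → List T} where
    tag-flatten : {ss : List S} (xs : All (λ s → All U (a s)) ss) →
                  tag (flatten {U = U} {a = a} xs) ≡ concatMapᵗ tag xs
    tag-flatten [] = refl
    tag-flatten (x ∷ xs) = trans (tag-++ᵗ x (flatten {U = U} {a = a} xs)) (cong (tag x ++_) (tag-flatten xs))

  lookup-allPositions : {Γ : List T} (ν : All U Γ) → All.map (All.lookup ν) (allPositions Γ) ≡ ν
  lookup-allPositions [] = refl
  lookup-allPositions (v ∷ ν) = cong (v ∷_) (trans (lookup-there ν (allPositions _)) (lookup-allPositions ν))
    where
    lookup-there : {Γ ts : List T} (ν : All U Γ) (a : All (_∈ Γ) ts) →
                   All.map (All.lookup (v ∷ ν)) (All.map there a) ≡ All.map (All.lookup ν) a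
    lookup-there ν [] = refl
    lookup-there ν (m ∷ a) = cong (_ ∷_) (lookup-there ν a)

  map-++ᵗ : {V : T → Set} (f : ∀ {t} → V t → U t) {xs ys : List T} (a : All V xs) (b : All V ys) →
            All.map f (a ++ᵗ b) ≡ All.map f a ++ᵗ All.map f b
  map-++ᵗ f [] b = refl
  map-++ᵗ f (u ∷ a) b = cong (_ ∷_) (map-++ᵗ f a b)

  lookup-∈-++⁺ˡ : {xs ys : List T} (w : All U (xs ++ ys)) {t : T} (m : t ∈ xs) →
                  All.lookup w (∈-++⁺ˡ {ys = ys} m) ≡ All.lookup (proj₁ (++⁻ xs w)) m
  lookup-∈-++⁺ˡ {x ∷ xs} (u ∷ w) (here refl) = refl
  lookup-∈-++⁺ˡ {x ∷ xs} (u ∷ w) (there m) = lookup-∈-++⁺ˡ w m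

  lookup-∈-++⁺ʳ : (xs : List T) {ys : List T} (w : All U (xs ++ ys)) {t : T} (m : t ∈ ys) →
                  All.lookup w (∈-++⁺ʳ xs m) ≡ All.lookup (proj₂ (++⁻ xs w)) m
  lookup-∈-++⁺ʳ [] w m = refl
  lookup-∈-++⁺ʳ (x ∷ xs) (u ∷ w) m = lookup-∈-++⁺ʳ xs w m

  map-lookup-∈-++⁺ˡ : {xs ys : List T} (w : All U (xs ++ ys)) {ts : List T} (a : All (_∈ xs) ts) →
                      All.map (All.lookup w) (All.map (∈-++⁺ˡ {ys = ys}) a) ≡ All.map (All.lookup (proj₁ (++⁻ xs w))) a
  map-lookup-∈-++⁺ˡ w [] = refl
  map-lookup-∈-++⁺ˡ w (m ∷ a) = cong₂ _∷_ (lookup-∈-++⁺ˡ w m) (map-lookup-∈-++⁺ˡ w a)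

  map-lookup-∈-++⁺ʳ : (xs : List T) {ys : List T} (w : All U (xs ++ ys)) {ts : List T} (a : All (_∈ ys) ts) →
                      All.map (All.lookup w) (All.map (∈-++⁺ʳ xs) a) ≡ All.map (All.lookup (proj₂ (++⁻ xs w))) a
  map-lookup-∈-++⁺ʳ xs w [] = refl
  map-lookup-∈-++⁺ʳ xs w (m ∷ a) = cong₂ _∷_ (lookup-∈-++⁺ʳ xs w m) (map-lookup-∈-++⁺ʳ xs w a)

  module _ (D : (t : T) → U t → Set) where
    Every-lookup : {Γ : List T} {ν : All U Γ} → Every D ν → ∀ {t} (m : t ∈ Γ) → D t (All.lookup ν m)
    Every-lookup {ν = v ∷ ν} (d , ds) (here refl) = d
    Every-lookup {ν = v ∷ ν} (d , ds) (there m) = Every-lookup ds m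

    Every-map-lookup : {Γ : List T} {ν : All U Γ} → Every D ν → ∀ {ts} (as : All (_∈ Γ) ts) →
                       Every D (All.map (All.lookup ν) as)
    Every-map-lookup e [] = tt
    Every-map-lookup e (m ∷ as) = Every-lookup e m , Every-map-lookup e as

    Every-++ᵗ : {xs ys : List T} {a : All U xs} {b : All U ys} → Every D a → Every D b → Every D (a ++ᵗ b)
    Every-++ᵗ {a = []} ea eb = eb
    Every-++ᵗ {a = u ∷ a} (d , ea) eb = d , Every-++ᵗ ea eb

    Every-subst : {xs ys : List T} (e : xs ≡ ys) {a : All U xs} → Every D a → Every D (subst (All U) e a)
    Every-subst refl d = d

  Every-map : {V : T → Set} (D₁ : (t : T) → U t → Set) (D₂ : (t : T) → V t → Set) (f : ∀ {t} → U t → V t) →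
              (∀ t x → D₁ t x → D₂ t (f x)) → {ts : List T} (ws : All U ts) → Every D₁ ws → Every D₂ (All.map f ws)
  Every-map D₁ D₂ f h [] _ = tt
  Every-map D₁ D₂ f h (w ∷ ws) (d , ds) = h _ w d , Every-map D₁ D₂ f h ws ds

module _ {T X : Set} where
  toList-++ᵗ : {xs ys : List T} (a : All (λ _ → X) xs) (b : All (λ _ → X) ys) →
               toList (a ++ᵗ b) ≡ toList a ++ toList b
  toList-++ᵗ [] b = refl
  toList-++ᵗ (u ∷ a) b = cong (u ∷_) (toList-++ᵗ a b)

  toList-subst : {xs ys : List T} (e : xs ≡ ys) (a : All (λ _ → X) xs) → toList (subst (All (λ _ → X)) e a) ≡ toList a
  toList-subst refl a = refl

  toList-map : {Y : Set} (f : Y → X) {xs : List T} (a : All (λ _ → Y) xs) → toList (All.map f a) ≡ List.map f (toList a)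
  toList-map f [] = refl
  toList-map f (u ∷ a) = cong (f u ∷_) (toList-map f a)

  toList-flatten : {S : Set} {a : S → List T} {ss : List S} (xs : All (λ s → All (λ _ → X) (a s)) ss) →
                   toList (flatten {U = λ _ → X} {a = a} xs) ≡ concatMapᵗ toList xs
  toList-flatten [] = refl
  toList-flatten {a = a} (x ∷ xs) =
    trans (toList-++ᵗ x (flatten {U = λ _ → X} {a = a} xs)) (cong (toList x ++_) (toList-flatten xs))

module _ {X T : Set} {V : T → Set} (ar : X → List T) (G : (x : X) → All V (ar x) → Set) where

  subst-args⇔ : {y x : X} (e : y ≡ x) {Γ : List T} (ν : All V Γ) (a : All (_∈ Γ) (ar x)) →
                G y (All.map (All.lookup ν) (subst (λ z → All (_∈ Γ) (ar z)) (sym e) a)) ⇔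
                G x (All.map (All.lookup ν) a)
  subst-args⇔ refl ν a = mk⇔ id id

map-subst : {X T : Set} {V W : T → Set} (h : X → List T) (f : ∀ {t} → V t → W t) {y x : X} (e : y ≡ x)
            (a : All V (h y)) → All.map f (subst (λ z → All V (h z)) e a) ≡ subst (λ z → All W (h z)) e (All.map f a)
map-subst h f e a = sym (subst-application′ (λ z → All _ (h z)) (λ _ → All.map f) e)

-- Datalog semantics

module _ {P : Signature} (prog : Program P) (A : Structure P) where
  open Program prog
  open Sem prog A

  Fact-dom : ∀ {s} {xs} → Fact s xs → Every (D A) xs
  Fact-dom {inj₁ R} (inp r) = relDom A R _ r
  Fact-dom (der r m ν dν h) = Every-map-lookup (D A) dν (Rule.headArgs r)

  Fact-input : ∀ {R} {xs} → Fact (inj₁ R) xs → rel A R xs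
  Fact-input (inp r) = r

  Extend : ((i : Fin nIdb) → All (U A) (idbAr i) → Set) →
           (s : Fin (nSym P) ⊎ Fin nIdb) → All (U A) (Δar P nIdb idbAr s) → Set
  Extend I (inj₁ R) = rel A R
  Extend I (inj₂ i) = I i

  Satisfies : ((i : Fin nIdb) → All (U A) (idbAr i) → Set) →
              {Γ : List (Fin (nTy P))} → All (U A) Γ → Atom P nIdb idbAr Γ → Set
  Satisfies I ν (relA s a) = Extend I s (All.map (All.lookup ν) a)
  Satisfies I ν (eqA m₁ m₂) = All.lookup ν m₁ ≡ All.lookup ν m₂

  Preserves : ((i : Fin nIdb) → All (U A) (idbAr i) → Set) → Rule P nIdb idbAr → Set
  Preserves I r = (ν : All (U A) (Rule.vars r)) → Every (D A) ν → All (Satisfies I ν) (Rule.body r) →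
                  I (Rule.head r) (All.map (All.lookup ν) (Rule.headArgs r))

  Fact-minimal : (I : (i : Fin nIdb) → All (U A) (idbAr i) → Set) → All (Preserves I) rules →
                 ∀ {s w} → Fact s w → Extend I s w
  Fact-minimal I pres = fact
    where
    fact : ∀ {s w} → Fact s w → Extend I s w
    body : ∀ {Γ} {ν : All (U A) Γ} (bs : List (Atom P nIdb idbAr Γ)) → All (Holds ν) bs → All (Satisfies I ν) bs
    fact (inp r) = r
    fact (der r m ν dν hs) = All.lookup pres m ν dν (body (Rule.body r) hs)
    body [] [] = []
    body (relA s a ∷ bs) (h ∷ hs) = fact h ∷ body bs hs
    body (eqA m₁ m₂ ∷ bs) (h ∷ hs) = h ∷ body bs hs

-- Expanding a signature by the outputs of programs, and inlining them

module Expansion (P : Signature) {B : Set} (B-finite : Finite B) (Π : B → Program P) where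

  Sym⁺ : Set
  Sym⁺ = Fin (nSym P) ⊎ B

  Sym⁺-finite : Finite Sym⁺
  Sym⁺-finite = Finite-⊎ (Finite-Fin (nSym P)) B-finite

  ar⁺ : Sym⁺ → List (Fin (nTy P))
  ar⁺ (inj₁ R) = ar P R
  ar⁺ (inj₂ b) = Program.outAr (Π b)

  P⁺ : Signature
  P⁺ = record { nTy = nTy P ; nSym = size Sym⁺-finite ; ar = λ c → ar⁺ (decode Sym⁺-finite c) }

  module _ (A : Structure P) where
    rel⁺ : (x : Sym⁺) → All (U A) (ar⁺ x) → Set
    rel⁺ (inj₁ R) = rel A R
    rel⁺ (inj₂ b) = Sem.Output (Π b) A

    rel⁺-dom : (x : Sym⁺) (xs : All (U A) (ar⁺ x)) → rel⁺ x xs → Every (D A) xs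
    rel⁺-dom (inj₁ R) xs r = relDom A R xs r
    rel⁺-dom (inj₂ b) xs r = Fact-dom (Π b) A r

    expand : Structure P⁺
    expand = record
      { U = U A ; D = D A
      ; rel = λ c → rel⁺ (decode Sym⁺-finite c) ; relDom = λ c → rel⁺-dom (decode Sym⁺-finite c) }

  expandedAtom : {nI : ℕ} {idbAr : Fin nI → List (Fin (nTy P))} {Γ : List (Fin (nTy P))}
                 (x : Sym⁺) → All (_∈ Γ) (ar⁺ x) → Atom P⁺ nI idbAr Γ
  expandedAtom {Γ = Γ} x a =
    relA (inj₁ (encode Sym⁺-finite x)) (subst (λ y → All (_∈ Γ) (ar⁺ y)) (sym (decode-encode Sym⁺-finite x)) a)

  expandedAtom⇔ : (A : Structure P) (x : Sym⁺) {Γ : List (Fin (nTy P))} (ν : All (U A) Γ) (a : All (_∈ Γ) (ar⁺ x)) →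
                  rel (expand A) (encode Sym⁺-finite x)
                    (All.map (All.lookup ν) (subst (λ y → All (_∈ Γ) (ar⁺ y)) (sym (decode-encode Sym⁺-finite x)) a))
                  ⇔ rel⁺ A x (All.map (All.lookup ν) a)
  expandedAtom⇔ A x = subst-args⇔ ar⁺ (rel⁺ A) (decode-encode Sym⁺-finite x)

  module Inline (Q : Program P⁺) where
    module Q = Program Q
    module Πb (b : B) = Program (Π b)

    Idb : Set
    Idb = Fin Q.nIdb ⊎ Σ B (λ b → Fin (Πb.nIdb b))

    Idb-finite : Finite Idb
    Idb-finite = Finite-⊎ (Finite-Fin Q.nIdb) (Finite-Σ B-finite (λ b → Finite-Fin (Πb.nIdb b)))

    idbArity : Idb → List (Fin (nTy P))
    idbArity (inj₁ ℓ) = Q.idbAr ℓ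
    idbArity (inj₂ (b , ℓ)) = Πb.idbAr b ℓ

    nIdb′ : ℕ
    nIdb′ = suc (size Idb-finite)

    idbAr′ : Fin nIdb′ → List (Fin (nTy P))
    idbAr′ zero = Q.outAr
    idbAr′ (suc e) = idbArity (decode Idb-finite e)

    At : List (Fin (nTy P)) → Set
    At Γ = Atom P nIdb′ idbAr′ Γ

    idbArgs : {Γ : List (Fin (nTy P))} (x : Idb) → All (_∈ Γ) (idbArity x) →
              All (_∈ Γ) (idbArity (decode Idb-finite (encode Idb-finite x)))
    idbArgs {Γ} x a = subst (λ y → All (_∈ Γ) (idbArity y)) (sym (decode-encode Idb-finite x)) a

    idbAtom : {Γ : List (Fin (nTy P))} (x : Idb) → All (_∈ Γ) (idbArity x) → At Γ
    idbAtom x a = relA (inj₂ (suc (encode Idb-finite x))) (idbArgs x a)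

    idbRule : (x : Idb) (vs : List (Fin (nTy P))) → All (_∈ vs) (idbArity x) → List (At vs) → Rule P nIdb′ idbAr′
    idbRule x vs h body = record { vars = vs ; head = suc (encode Idb-finite x) ; headArgs = idbArgs x h ; body = body }

    translateΠ : (b : B) {Γ : List (Fin (nTy P))} → Atom P (Πb.nIdb b) (Πb.idbAr b) Γ → At Γ
    translateΠ b (relA (inj₁ R) a) = relA (inj₁ R) a
    translateΠ b (relA (inj₂ ℓ) a) = idbAtom (inj₂ (b , ℓ)) a
    translateΠ b (eqA m₁ m₂) = eqA m₁ m₂

    translateSym⁺ : {Γ : List (Fin (nTy P))} (x : Sym⁺) → All (_∈ Γ) (ar⁺ x) → At Γ
    translateSym⁺ (inj₁ R) a = relA (inj₁ R) a
    translateSym⁺ (inj₂ b) a = translateΠ b (relA (Πb.out b) a)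

    translateQ : {Γ : List (Fin (nTy P))} → Atom P⁺ Q.nIdb Q.idbAr Γ → At Γ
    translateQ (relA (inj₁ c) a) = translateSym⁺ (decode Sym⁺-finite c) a
    translateQ (relA (inj₂ ℓ) a) = idbAtom (inj₁ ℓ) a
    translateQ (eqA m₁ m₂) = eqA m₁ m₂

    -- Q.out may be an input symbol of P⁺, so the output gets an IDB of its own.
    outputRule : Rule P nIdb′ idbAr′
    outputRule = record
      { vars = Q.outAr ; head = zero ; headArgs = allPositions Q.outAr
      ; body = translateQ (relA Q.out (allPositions Q.outAr)) ∷ [] }

    ruleQ : Rule P⁺ Q.nIdb Q.idbAr → Rule P nIdb′ idbAr′
    ruleQ r = idbRule (inj₁ (Rule.head r)) (Rule.vars r) (Rule.headArgs r) (List.map translateQ (Rule.body r))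

    ruleΠ : (b : B) → Rule P (Πb.nIdb b) (Πb.idbAr b) → Rule P nIdb′ idbAr′
    ruleΠ b r = idbRule (inj₂ (b , Rule.head r)) (Rule.vars r) (Rule.headArgs r) (List.map (translateΠ b) (Rule.body r))

    rulesΠ : List (Rule P nIdb′ idbAr′)
    rulesΠ = cmap (λ b → List.map (ruleΠ b) (Πb.rules b)) (enumerate B-finite)

    inlined : Program P
    inlined = record
      { nIdb = nIdb′ ; idbAr = idbAr′ ; rules = outputRule ∷ (List.map ruleQ Q.rules ++ rulesΠ) ; out = inj₂ zero }

    module _ (A : Structure P) where
      private
        module M = Sem inlined A
        module SQ = Sem Q (expand A)
        module SΠ (b : B) = Sem (Π b) A

      IdbMeaning : (x : Idb) → All (U A) (idbArity x) → Set
      IdbMeaning (inj₁ ℓ) = SQ.Fact (inj₂ ℓ)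
      IdbMeaning (inj₂ (b , ℓ)) = SΠ.Fact b (inj₂ ℓ)

      Meaning : (i : Fin nIdb′) → All (U A) (idbAr′ i) → Set
      Meaning zero = SQ.Output
      Meaning (suc e) = IdbMeaning (decode Idb-finite e)

      private
        Sat : {Γ : List (Fin (nTy P))} → All (U A) Γ → At Γ → Set
        Sat = Satisfies inlined A Meaning

        idbArgs⇔ : (x : Idb) {Γ : List (Fin (nTy P))} (ν : All (U A) Γ) (a : All (_∈ Γ) (idbArity x)) →
                   Meaning (suc (encode Idb-finite x)) (All.map (All.lookup ν) (idbArgs x a)) ⇔
                   IdbMeaning x (All.map (All.lookup ν) a)
        idbArgs⇔ x = subst-args⇔ idbArity IdbMeaning (decode-encode Idb-finite x)

        translateΠ-sound : (b : B) {Γ : List (Fin (nTy P))} (ν : All (U A) Γ) (a : Atom P (Πb.nIdb b) (Πb.idbAr b) Γ) →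
                           Sat ν (translateΠ b a) → SΠ.Holds b ν a
        translateΠ-sound b ν (relA (inj₁ R) a) g = SΠ.inp g
        translateΠ-sound b ν (relA (inj₂ ℓ) a) g = Equivalence.to (idbArgs⇔ (inj₂ (b , ℓ)) ν a) g
        translateΠ-sound b ν (eqA m₁ m₂) g = g

        translateSym⁺-sound : {Γ : List (Fin (nTy P))} (ν : All (U A) Γ) (x : Sym⁺) (a : All (_∈ Γ) (ar⁺ x)) →
                              Sat ν (translateSym⁺ x a) → rel⁺ A x (All.map (All.lookup ν) a)
        translateSym⁺-sound ν (inj₁ R) a g = g
        translateSym⁺-sound ν (inj₂ b) a g = translateΠ-sound b ν (relA (Πb.out b) a) g

        translateQ-sound : {Γ : List (Fin (nTy P))} (ν : All (U A) Γ) (a : Atom P⁺ Q.nIdb Q.idbAr Γ) →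
                           Sat ν (translateQ a) → SQ.Holds ν a
        translateQ-sound ν (relA (inj₁ c) a) g = SQ.inp (translateSym⁺-sound ν (decode Sym⁺-finite c) a g)
        translateQ-sound ν (relA (inj₂ ℓ) a) g = Equivalence.to (idbArgs⇔ (inj₁ ℓ) ν a) g
        translateQ-sound ν (eqA m₁ m₂) g = g

        rules-preserve : All (Preserves inlined A Meaning) (Program.rules inlined)
        rules-preserve =
          (λ { ν _ (g ∷ []) → translateQ-sound ν _ g }) ∷
          ++⁺ (map⁺ (All.tabulate λ {r} m ν dν gs →
                 Equivalence.from (idbArgs⇔ (inj₁ (Rule.head r)) ν (Rule.headArgs r))
                   (SQ.der r m ν dν (All.map (λ {a} → translateQ-sound ν a) (map⁻ gs)))))
              (All-cmap⁺ (enumerate B-finite) λ b _ → map⁺ (All.tabulate λ {r} m ν dν gs →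
                 Equivalence.from (idbArgs⇔ (inj₂ (b , Rule.head r)) ν (Rule.headArgs r))
                   (SΠ.der r m ν dν (All.map (λ {a} → translateΠ-sound b ν a) (map⁻ gs)))))

        Derived : (x : Idb) → All (U A) (idbArity x) → Set
        Derived x w = M.Fact (inj₂ (suc (encode Idb-finite x)))
                        (subst (λ z → All (U A) (idbArity z)) (sym (decode-encode Idb-finite x)) w)

        idbArgs-lookup : (x : Idb) {Γ : List (Fin (nTy P))} (ν : All (U A) Γ) (a : All (_∈ Γ) (idbArity x)) →
                         All.map (All.lookup ν) (idbArgs x a) ≡
                         subst (λ z → All (U A) (idbArity z)) (sym (decode-encode Idb-finite x)) (All.map (All.lookup ν) a)
        idbArgs-lookup x ν a = map-subst idbArity (All.lookup ν) (sym (decode-encode Idb-finite x)) a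

        completeΠ : (b : B) {ℓ : Fin (Πb.nIdb b)} {w : All (U A) (Πb.idbAr b ℓ)} →
                    SΠ.Fact b (inj₂ ℓ) w → Derived (inj₂ (b , ℓ)) w
        completeΠ-atom : (b : B) {Γ : List (Fin (nTy P))} (ν : All (U A) Γ) (a : Atom P (Πb.nIdb b) (Πb.idbAr b) Γ) →
                         SΠ.Holds b ν a → M.Holds ν (translateΠ b a)
        completeΠ-body : (b : B) {Γ : List (Fin (nTy P))} (ν : All (U A) Γ)
                         (bs : List (Atom P (Πb.nIdb b) (Πb.idbAr b) Γ)) →
                         All (SΠ.Holds b ν) bs → All (M.Holds ν) (List.map (translateΠ b) bs)
        completeΠ b (SΠ.der r m ν dν hs) =
          subst (M.Fact _) (idbArgs-lookup (inj₂ (b , Rule.head r)) ν (Rule.headArgs r))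
            (M.der (ruleΠ b r) ruleΠ∈ ν dν (completeΠ-body b ν (Rule.body r) hs))
          where
          ruleΠ∈ : ruleΠ b r ∈ Program.rules inlined
          ruleΠ∈ = there (∈-++⁺ʳ (List.map ruleQ Q.rules)
                     (∈-cmap (enumerate B-finite) (∈-enumerate B-finite b) (∈-map⁺ (ruleΠ b) m)))
        completeΠ-atom b ν (relA (inj₁ R) a) h = M.inp (Fact-input (Π b) A h)
        completeΠ-atom b ν (relA (inj₂ ℓ) a) h =
          subst (M.Fact _) (sym (idbArgs-lookup (inj₂ (b , ℓ)) ν a)) (completeΠ b h)
        completeΠ-atom b ν (eqA m₁ m₂) h = h
        completeΠ-body b ν [] [] = []
        completeΠ-body b ν (a ∷ bs) (h ∷ hs) = completeΠ-atom b ν a h ∷ completeΠ-body b ν bs hs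

        completeQ : {ℓ : Fin Q.nIdb} {w : All (U A) (Q.idbAr ℓ)} → SQ.Fact (inj₂ ℓ) w → Derived (inj₁ ℓ) w
        completeQ-atom : {Γ : List (Fin (nTy P))} (ν : All (U A) Γ) (a : Atom P⁺ Q.nIdb Q.idbAr Γ) →
                         SQ.Holds ν a → M.Holds ν (translateQ a)
        completeQ-body : {Γ : List (Fin (nTy P))} (ν : All (U A) Γ) (bs : List (Atom P⁺ Q.nIdb Q.idbAr Γ)) →
                         All (SQ.Holds ν) bs → All (M.Holds ν) (List.map translateQ bs)
        completeSym⁺ : {Γ : List (Fin (nTy P))} (ν : All (U A) Γ) (x : Sym⁺) (a : All (_∈ Γ) (ar⁺ x)) →
                       rel⁺ A x (All.map (All.lookup ν) a) → M.Holds ν (translateSym⁺ x a)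
        completeQ (SQ.der r m ν dν hs) =
          subst (M.Fact _) (idbArgs-lookup (inj₁ (Rule.head r)) ν (Rule.headArgs r))
            (M.der (ruleQ r) (there (∈-++⁺ˡ (∈-map⁺ ruleQ m))) ν dν (completeQ-body ν (Rule.body r) hs))
        completeQ-atom ν (relA (inj₁ c) a) h = completeSym⁺ ν (decode Sym⁺-finite c) a (Fact-input Q (expand A) h)
        completeQ-atom ν (relA (inj₂ ℓ) a) h = subst (M.Fact _) (sym (idbArgs-lookup (inj₁ ℓ) ν a)) (completeQ h)
        completeQ-atom ν (eqA m₁ m₂) h = h
        completeQ-body ν [] [] = []
        completeQ-body ν (a ∷ bs) (h ∷ hs) = completeQ-atom ν a h ∷ completeQ-body ν bs hs
        completeSym⁺ ν (inj₁ R) a r = M.inp r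
        completeSym⁺ ν (inj₂ b) a r = completeΠ-atom b ν (relA (Πb.out b) a) r

        complete : {w : All (U A) Q.outAr} → SQ.Output w → M.Output w
        complete {w} o = subst M.Output (lookup-allPositions w)
          (M.der outputRule (here refl) w (Fact-dom Q (expand A) o)
             (completeQ-atom w (relA Q.out (allPositions Q.outAr))
                (subst SQ.Output (sym (lookup-allPositions w)) o) ∷ []))

      inlined-correct : (w : All (U A) Q.outAr) → Sem.Output inlined A w ⇔ Sem.Output Q (expand A) w
      inlined-correct w = mk⇔ (Fact-minimal inlined A Meaning rules-preserve) complete

-- Simulating programs on υ(φI(A)) by programs on A

module Simulation {P M S : Signature} (φI : Interp P M) (υ : Gadget M S) where
  module φ = Interp φI
  module υ = Gadget υ

  oT : Fin (nTy M) → List (Fin (nTy P))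
  oT i = Program.outAr (φ.progT i)

  Choice : List (Fin (nTy S)) → Set
  Choice ts = All (λ _ → Fin (nTy M)) ts

  Choice-finite : (ts : List (Fin (nTy S))) → Finite (Choice ts)
  Choice-finite = Finite-All (λ _ → Fin (nTy M)) (λ _ → Finite-Fin (nTy M))

  choiceAr : {ts : List (Fin (nTy S))} → Choice ts → List (Fin (nTy P))
  choiceAr κ = cmap oT (toList κ)

  block : {Γ : List (Fin (nTy S))} (κ : Choice Γ) {t : Fin (nTy S)} (m : t ∈ Γ) →
          All (_∈ choiceAr κ) (oT (All.lookup κ m))
  block (i ∷ κ) (here refl) = All.map ∈-++⁺ˡ (allPositions (oT i))
  block (i ∷ κ) (there m) = All.map (∈-++⁺ʳ (oT i)) (block κ m)

  blocks : {Γ ts : List (Fin (nTy S))} (κ : Choice Γ) (as : All (_∈ Γ) ts) →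
           All (_∈ choiceAr κ) (choiceAr (All.map (All.lookup κ) as))
  blocks κ [] = []
  blocks κ (m ∷ as) = block κ m ++ᵗ blocks κ as

  relAr≡ : (R : Fin (nSym M)) {ts : List (Fin (nTy S))} (κ : Choice ts) → toList κ ≡ ar M R →
           Program.outAr (φ.progR R) ≡ choiceAr κ
  relAr≡ R κ e = trans (φ.arOK R) (cong (cmap oT) (sym e))

  module Tuples (A : Structure P) where
    φA : Structure M
    φA = applyI φI A

    C : Structure S
    C = applyG υ φA

    UC : Set
    UC = Σ (Fin (nTy M)) (U φA)

    unflatten : {ts : List (Fin (nTy S))} (κ : Choice ts) → All (U A) (choiceAr κ) → All (U C) ts
    unflatten [] w = []
    unflatten (i ∷ κ) w = (i , proj₁ (++⁻ (oT i) w)) ∷ unflatten κ (proj₂ (++⁻ (oT i) w))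

    choiceOf : {ts : List (Fin (nTy S))} → All (U C) ts → Choice ts
    choiceOf [] = []
    choiceOf (c ∷ cs) = proj₁ c ∷ choiceOf cs

    flatOf : {ts : List (Fin (nTy S))} (cs : All (U C) ts) → All (U A) (choiceAr (choiceOf cs))
    flatOf [] = []
    flatOf ((i , p) ∷ cs) = p ++ᵗ flatOf cs

    Flat : List (Fin (nTy S)) → Set
    Flat ts = Σ (Choice ts) (λ κ → All (U A) (choiceAr κ))

    flatOf-unflatten : {ts : List (Fin (nTy S))} (κ : Choice ts) (w : All (U A) (choiceAr κ)) →
                       _≡_ {A = Flat ts} (choiceOf (unflatten κ w) , flatOf (unflatten κ w)) (κ , w)
    flatOf-unflatten [] [] = refl
    flatOf-unflatten (i ∷ κ) w =
      trans (cong (λ q → (i ∷ proj₁ q) , (proj₁ (++⁻ (oT i) w) ++ᵗ proj₂ q))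
                  (flatOf-unflatten κ (proj₂ (++⁻ (oT i) w))))
            (cong (λ w′ → _,_ {B = λ κ → All (U A) (choiceAr κ)} (i ∷ κ) w′) (++ᵗ-++⁻ (oT i) w))

    unflatten-flatOf : {ts : List (Fin (nTy S))} (cs : All (U C) ts) → unflatten (choiceOf cs) (flatOf cs) ≡ cs
    unflatten-flatOf [] = refl
    unflatten-flatOf ((i , p) ∷ cs) rewrite ++⁻-++ᵗ p (flatOf cs) = cong ((i , p) ∷_) (unflatten-flatOf cs)

    unflatten-injective : {ts : List (Fin (nTy S))} (κ κ′ : Choice ts)
                          (w : All (U A) (choiceAr κ)) (w′ : All (U A) (choiceAr κ′)) →
                          unflatten κ w ≡ unflatten κ′ w′ → _≡_ {A = Flat ts} (κ , w) (κ′ , w′)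
    unflatten-injective κ κ′ w w′ e =
      trans (sym (flatOf-unflatten κ w)) (trans (cong (λ cs → choiceOf cs , flatOf cs) e) (flatOf-unflatten κ′ w′))

    lookup-unflatten : {Γ : List (Fin (nTy S))} (κ : Choice Γ) (w : All (U A) (choiceAr κ))
                       {t : Fin (nTy S)} (m : t ∈ Γ) →
                       All.lookup (unflatten κ w) m ≡ (All.lookup κ m , All.map (All.lookup w) (block κ m))
    lookup-unflatten (i ∷ κ) w (here refl) =
      cong (i ,_) (sym (trans (map-lookup-∈-++⁺ˡ w (allPositions (oT i))) (lookup-allPositions _)))
    lookup-unflatten (i ∷ κ) w (there m) =
      trans (lookup-unflatten κ (proj₂ (++⁻ (oT i) w)) m)
            (cong (All.lookup κ m ,_) (sym (map-lookup-∈-++⁺ʳ (oT i) w (block κ m))))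

    unflatten-blocks : {Γ ts : List (Fin (nTy S))} (κ : Choice Γ) (w : All (U A) (choiceAr κ)) (as : All (_∈ Γ) ts) →
                       unflatten (All.map (All.lookup κ) as) (All.map (All.lookup w) (blocks κ as)) ≡
                       All.map (All.lookup (unflatten κ w)) as
    unflatten-blocks κ w [] = refl
    unflatten-blocks κ w (m ∷ as)
      rewrite map-++ᵗ (All.lookup w) (block κ m) (blocks κ as)
            | ++⁻-++ᵗ (All.map (All.lookup w) (block κ m)) (All.map (All.lookup w) (blocks κ as))
      = cong₂ _∷_ (sym (lookup-unflatten κ w m)) (unflatten-blocks κ w as)

    lookup-choiceOf : {Γ : List (Fin (nTy S))} (cs : All (U C) Γ) {t : Fin (nTy S)} (m : t ∈ Γ) →
                      All.lookup (choiceOf cs) m ≡ proj₁ (All.lookup cs m)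
    lookup-choiceOf (c ∷ cs) (here refl) = refl
    lookup-choiceOf (c ∷ cs) (there m) = lookup-choiceOf cs m

    flatOf-dom : {ts : List (Fin (nTy S))} (cs : All (U C) ts) → Every (D C) cs → Every (D A) (flatOf cs)
    flatOf-dom [] _ = tt
    flatOf-dom ((i , p) ∷ cs) (dc , ds) = Every-++ᵗ (D A) (Fact-dom (φ.progT i) A (proj₂ dc)) (flatOf-dom cs ds)

    pieces : {ts : List (Fin (nTy S))} (κ : Choice ts) → All (U A) (choiceAr κ) → All (U φA) (toList κ)
    pieces [] w = []
    pieces (i ∷ κ) w = proj₁ (++⁻ (oT i) w) ∷ pieces κ (proj₂ (++⁻ (oT i) w))

    toList-unflatten : {ts : List (Fin (nTy S))} (κ : Choice ts) (w : All (U A) (choiceAr κ)) →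
                       toList (unflatten κ w) ≡ tag (pieces κ w)
    toList-unflatten [] w = refl
    toList-unflatten (i ∷ κ) w = cong ((i , proj₁ (++⁻ (oT i) w)) ∷_) (toList-unflatten κ _)

    flatten-pieces : {ts : List (Fin (nTy S))} (κ : Choice ts) (w : All (U A) (choiceAr κ)) →
                     flatten {U = U A} {a = oT} (pieces κ w) ≡ w
    flatten-pieces [] [] = refl
    flatten-pieces (i ∷ κ) w =
      trans (cong (proj₁ (++⁻ (oT i) w) ++ᵗ_) (flatten-pieces κ _)) (++ᵗ-++⁻ (oT i) w)

    pieces-dom : {ts : List (Fin (nTy S))} (κ : Choice ts) (w : All (U A) (choiceAr κ)) →
                 Every (D C) (unflatten κ w) → Every (D φA) (pieces κ w)
    pieces-dom [] w _ = tt
    pieces-dom (i ∷ κ) w ((_ , d) , ds) = d , pieces-dom κ _ ds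

    toList-choiceOf : {ts : List (Fin (nTy S))} (cs : All (U C) ts) → toList (choiceOf cs) ≡ List.map proj₁ (toList cs)
    toList-choiceOf [] = refl
    toList-choiceOf (c ∷ cs) = cong (_ ∷_) (toList-choiceOf cs)

    map-proj₁-tag : {ts : List (Fin (nTy M))} (xs : All (U φA) ts) → List.map proj₁ (tag xs) ≡ ts
    map-proj₁-tag [] = refl
    map-proj₁-tag (x ∷ xs) = cong (_ ∷_) (map-proj₁-tag xs)

    tag-flatOf : {ts : List (Fin (nTy S))} (cs : All (U C) ts) →
                 tag (flatOf cs) ≡ cmap (λ p → tag (proj₂ p)) (toList cs)
    tag-flatOf [] = refl
    tag-flatOf ((i , p) ∷ cs) = trans (tag-++ᵗ p (flatOf cs)) (cong (tag p ++_) (tag-flatOf cs))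

    tag-flatten-pairs : {ts : List (Fin (nTy M))} (xs : All (U φA) ts) →
                        tag (flatten {U = U A} {a = oT} xs) ≡ cmap (λ p → tag (proj₂ p)) (tag xs)
    tag-flatten-pairs [] = refl
    tag-flatten-pairs (x ∷ xs) =
      trans (tag-++ᵗ x (flatten {U = U A} {a = oT} xs)) (cong (tag x ++_) (tag-flatten-pairs xs))

    tag-flatten-subst : {ts ts′ : List (Fin (nTy M))} (e : ts ≡ ts′) (xs : All (U φA) ts) →
                        tag (flatten {U = U A} {a = oT} (subst (All (U φA)) e xs)) ≡ tag (flatten {U = U A} {a = oT} xs)
    tag-flatten-subst refl xs = refl

    rel-unflatten : (Sy : Fin (nSym S)) (κ : Choice (ar S Sy)) (w : All (U A) (choiceAr κ))
                    (R : Fin (nSym M)) → υ.r R ≡ Sy → (e : toList κ ≡ ar M R) →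
                    Every (D C) (unflatten κ w) → Sem.Output (φ.progR R) A (subst (All (U A)) (sym (relAr≡ R κ e)) w) →
                    rel C Sy (unflatten κ w)
    rel-unflatten Sy κ w R rR≡Sy e dom out =
      dom , R , rR≡Sy , xs , (Every-subst (D φA) e (pieces-dom κ w dom) , subst (Sem.Output (φ.progR R) A) w≡ out) ,
      trans (toList-unflatten κ w) (sym (tag-subst (λ z → z) e (pieces κ w)))
      where
      xs : All (U φA) (ar M R)
      xs = subst (All (U φA)) e (pieces κ w)
      w≡ : subst (All (U A)) (sym (relAr≡ R κ e)) w ≡ subst (All (U A)) (sym (φ.arOK R)) (flatten xs)
      w≡ = tag-injective _ _ (trans (tag-subst (λ z → z) (sym (relAr≡ R κ e)) w)
             (sym (trans (tag-subst (λ z → z) (sym (φ.arOK R)) (flatten xs))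
                  (trans (tag-flatten-subst e (pieces κ w)) (cong tag (flatten-pieces κ w))))))

    rel-flatOf : (Sy : Fin (nSym S)) (cs : All (U C) (ar S Sy)) → rel C Sy cs →
                 Σ[ R ∈ Fin (nSym M) ] (υ.r R ≡ Sy × Σ[ e ∈ toList (choiceOf cs) ≡ ar M R ]
                   Sem.Output (φ.progR R) A (subst (All (U A)) (sym (relAr≡ R (choiceOf cs) e)) (flatOf cs)))
    rel-flatOf Sy cs (_ , R , rR≡Sy , xs , (_ , out) , cs≡xs) = R , rR≡Sy , e , subst (Sem.Output (φ.progR R) A) xs≡ out
      where
      e : toList (choiceOf cs) ≡ ar M R
      e = trans (toList-choiceOf cs) (trans (cong (List.map proj₁) cs≡xs) (map-proj₁-tag xs))
      xs≡ : subst (All (U A)) (sym (φ.arOK R)) (flatten xs) ≡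
            subst (All (U A)) (sym (relAr≡ R (choiceOf cs) e)) (flatOf cs)
      xs≡ = tag-injective _ _ (trans (tag-subst (λ z → z) (sym (φ.arOK R)) (flatten xs))
              (trans (tag-flatten-pairs xs) (trans (cong (cmap (λ p → tag (proj₂ p))) (sym cs≡xs))
                (trans (sym (tag-flatOf cs))
                       (sym (tag-subst (λ z → z) (sym (relAr≡ R (choiceOf cs) e)) (flatOf cs)))))))

  Base : Set
  Base = Fin (nTy M) ⊎ Fin (nSym M)

  Π : Base → Program P
  Π (inj₁ i) = φ.progT i
  Π (inj₂ R) = φ.progR R

  open Expansion P (Finite-⊎ (Finite-Fin (nTy M)) (Finite-Fin (nSym M))) Π public

  module Translate (Q : Program S) where
    module Q = Program Q

    ΔQ : Fin (nSym S) ⊎ Fin Q.nIdb → List (Fin (nTy S))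
    ΔQ = Δar S Q.nIdb Q.idbAr

    Idx : Set
    Idx = Σ (Fin (nSym S) ⊎ Fin Q.nIdb) (λ s → Choice (ΔQ s))

    Idx-finite : Finite Idx
    Idx-finite = Finite-Σ (Finite-⊎ (Finite-Fin (nSym S)) (Finite-Fin Q.nIdb)) (λ s → Choice-finite (ΔQ s))

    idxAr : Idx → List (Fin (nTy P))
    idxAr x = choiceAr (proj₂ x)

    AtomQ : List (Fin (nTy S)) → Set
    AtomQ Γ = Atom S Q.nIdb Q.idbAr Γ

    ChoiceRespects : {Γ : List (Fin (nTy S))} → Choice Γ → AtomQ Γ → Set
    ChoiceRespects κ (relA s as) = ⊤
    ChoiceRespects κ (eqA m₁ m₂) = All.lookup κ m₁ ≡ All.lookup κ m₂

    choiceRespects? : {Γ : List (Fin (nTy S))} (κ : Choice Γ) (a : AtomQ Γ) → Dec (ChoiceRespects κ a)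
    choiceRespects? κ (relA s as) = yes tt
    choiceRespects? κ (eqA m₁ m₂) = All.lookup κ m₁ ≟ All.lookup κ m₂

    WellTyped : {Γ : List (Fin (nTy S))} → Choice Γ → Set
    WellTyped κ = Every (λ t i → υ.d i ≡ t) κ

    wellTyped? : {Γ : List (Fin (nTy S))} (κ : Choice Γ) → Dec (WellTyped κ)
    wellTyped? [] = yes tt
    wellTyped? (i ∷ κ) = (υ.d i ≟ _) ×-dec wellTyped? κ

    Admissible : (r : Rule S Q.nIdb Q.idbAr) → Choice (Rule.vars r) → Set
    Admissible r κ = WellTyped κ × All (ChoiceRespects κ) (Rule.body r)

    admissible? : (r : Rule S Q.nIdb Q.idbAr) (κ : Choice (Rule.vars r)) → Dec (Admissible r κ)
    admissible? r κ = wellTyped? κ ×-dec All.all? (choiceRespects? κ) (Rule.body r)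

    -- The output arity L is only propositionally equal to choiceAr κo, so that the arity
    -- condition of the composed interpretation can hold definitionally.
    module Simulate (L : List (Fin (nTy P))) (κo : Choice Q.outAr) (L≡ : L ≡ choiceAr κo) where
      nIdb′ : ℕ
      nIdb′ = suc (size Idx-finite)

      idbAr′ : Fin nIdb′ → List (Fin (nTy P))
      idbAr′ zero = L
      idbAr′ (suc e) = idxAr (decode Idx-finite e)

      At : List (Fin (nTy P)) → Set
      At Γ = Atom P⁺ nIdb′ idbAr′ Γ

      idxArgs : {Γ : List (Fin (nTy P))} (x : Idx) → All (_∈ Γ) (idxAr x) →
                All (_∈ Γ) (idxAr (decode Idx-finite (encode Idx-finite x)))
      idxArgs {Γ} x a = subst (λ y → All (_∈ Γ) (idxAr y)) (sym (decode-encode Idx-finite x)) a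

      idxAtom : {Γ : List (Fin (nTy P))} (x : Idx) → All (_∈ Γ) (idxAr x) → At Γ
      idxAtom x a = relA (inj₂ (suc (encode Idx-finite x))) (idxArgs x a)

      idxRule : (x : Idx) (vs : List (Fin (nTy P))) → All (_∈ vs) (idxAr x) → List (At vs) → Rule P⁺ nIdb′ idbAr′
      idxRule x vs h body = record { vars = vs ; head = suc (encode Idx-finite x) ; headArgs = idxArgs x h ; body = body }

      -- Variables of Q range over the domain of C: the block of each must be an output of φ.progT.
      domainAtoms : {Γ ts : List (Fin (nTy S))} (κ : Choice Γ) → All (_∈ Γ) ts → List (At (choiceAr κ))
      domainAtoms κ [] = []
      domainAtoms κ (m ∷ as) = expandedAtom (inj₂ (inj₁ (All.lookup κ m))) (block κ m) ∷ domainAtoms κ as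

      equalityAtoms : {V l : List (Fin (nTy P))} → All (_∈ V) l → All (_∈ V) l → List (At V)
      equalityAtoms [] [] = []
      equalityAtoms (m ∷ a) (m′ ∷ b) = eqA m m′ ∷ equalityAtoms a b

      translateAtom : {Γ : List (Fin (nTy S))} (κ : Choice Γ) → AtomQ Γ → List (At (choiceAr κ))
      translateAtom κ (relA s as) = idxAtom (s , All.map (All.lookup κ) as) (blocks κ as) ∷ []
      translateAtom κ (eqA m₁ m₂) with All.lookup κ m₁ ≟ All.lookup κ m₂
      ... | yes e = equalityAtoms (block κ m₁) (subst (λ i → All (_∈ choiceAr κ) (oT i)) (sym e) (block κ m₂))
      ... | no _ = []  -- never used: only choices respecting the equalities of a rule are simulated

      outputRule : Rule P⁺ nIdb′ idbAr′
      outputRule = record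
        { vars = L ; head = zero ; headArgs = allPositions L
        ; body = idxAtom (Q.out , κo) (subst (All (_∈ L)) L≡ (allPositions L)) ∷ [] }

      inputRule : (Sy : Fin (nSym S)) (κ : Choice (ar S Sy)) (R : Fin (nSym M)) → toList κ ≡ ar M R → Rule P⁺ nIdb′ idbAr′
      inputRule Sy κ R e = idxRule (inj₁ Sy , κ) (choiceAr κ) (allPositions (choiceAr κ))
        (expandedAtom (inj₂ (inj₂ R)) (subst (All (_∈ choiceAr κ)) (sym (relAr≡ R κ e)) (allPositions (choiceAr κ)))
         ∷ domainAtoms κ (allPositions (ar S Sy)))

      inputRules : (Sy : Fin (nSym S)) (κ : Choice (ar S Sy)) (R : Fin (nSym M)) → List (Rule P⁺ nIdb′ idbAr′)
      inputRules Sy κ R =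
        whenDec (υ.r R ≟ Sy) λ _ → whenDec (≡-dec _≟_ (toList κ) (ar M R)) λ e → inputRule Sy κ R e ∷ []

      allInputRules : List (Rule P⁺ nIdb′ idbAr′)
      allInputRules = cmap (λ Sy → cmap (λ κ → cmap (inputRules Sy κ) (allFin (nSym M)))
                                         (enumerate (Choice-finite (ar S Sy))))
                           (allFin (nSym S))

      simulatedRule : (r : Rule S Q.nIdb Q.idbAr) (κ : Choice (Rule.vars r)) → Rule P⁺ nIdb′ idbAr′
      simulatedRule r κ =
        idxRule (inj₂ (Rule.head r) , All.map (All.lookup κ) (Rule.headArgs r)) (choiceAr κ) (blocks κ (Rule.headArgs r))
          (domainAtoms κ (allPositions (Rule.vars r)) ++ cmap (translateAtom κ) (Rule.body r))

      simulatedRules : (r : Rule S Q.nIdb Q.idbAr) (κ : Choice (Rule.vars r)) → List (Rule P⁺ nIdb′ idbAr′)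
      simulatedRules r κ = whenDec (admissible? r κ) λ _ → simulatedRule r κ ∷ []

      allSimulatedRules : List (Rule P⁺ nIdb′ idbAr′)
      allSimulatedRules = cmap (λ r → cmap (simulatedRules r) (enumerate (Choice-finite (Rule.vars r)))) Q.rules

      simulation : Program P⁺
      simulation = record
        { nIdb = nIdb′ ; idbAr = idbAr′ ; rules = outputRule ∷ (allInputRules ++ allSimulatedRules) ; out = inj₂ zero }

      module _ (A : Structure P) where
        open Tuples A
        private
          module T = Sem simulation (expand A)
          module SQ = Sem Q C

        IdxMeaning : (x : Idx) → All (U A) (idxAr x) → Set
        IdxMeaning (s , κ) w = SQ.Fact s (unflatten κ w)

        Meaning : (i : Fin nIdb′) → All (U A) (idbAr′ i) → Set
        Meaning zero w = SQ.Output (unflatten κo (subst (All (U A)) L≡ w))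
        Meaning (suc e) = IdxMeaning (decode Idx-finite e)

        private
          Sat : {Γ : List (Fin (nTy P))} → All (U A) Γ → At Γ → Set
          Sat = Satisfies simulation (expand A) Meaning

          idxArgs⇔ : (x : Idx) {Γ : List (Fin (nTy P))} (ν : All (U A) Γ) (a : All (_∈ Γ) (idxAr x)) →
                     Meaning (suc (encode Idx-finite x)) (All.map (All.lookup ν) (idxArgs x a)) ⇔
                     IdxMeaning x (All.map (All.lookup ν) a)
          idxArgs⇔ x = subst-args⇔ idxAr IdxMeaning (decode-encode Idx-finite x)

          base-sound : {Γ : List (Fin (nTy P))} (ν : All (U A) Γ) (b : Base) (a : All (_∈ Γ) (ar⁺ (inj₂ b))) →
                       Sat ν (expandedAtom (inj₂ b) a) → Sem.Output (Π b) A (All.map (All.lookup ν) a)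
          base-sound ν b a = Equivalence.to (expandedAtom⇔ A (inj₂ b) ν a)

          domainAtoms-sound : {Γ ts : List (Fin (nTy S))} (κ : Choice Γ) (w : All (U A) (choiceAr κ))
                              (as : All (_∈ Γ) ts) → WellTyped κ → All (Sat w) (domainAtoms κ as) →
                              Every (D C) (All.map (All.lookup (unflatten κ w)) as)
          domainAtoms-sound κ w [] typed [] = tt
          domainAtoms-sound κ w (m ∷ as) typed (g ∷ gs) =
            subst (D C _) (sym (lookup-unflatten κ w m))
                  (Every-lookup (λ t i → υ.d i ≡ t) typed m , base-sound w (inj₁ (All.lookup κ m)) (block κ m) g)
            , domainAtoms-sound κ w as typed gs

          unflatten-dom : {Γ : List (Fin (nTy S))} (κ : Choice Γ) (w : All (U A) (choiceAr κ)) →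
                          WellTyped κ → All (Sat w) (domainAtoms κ (allPositions Γ)) → Every (D C) (unflatten κ w)
          unflatten-dom κ w typed gs =
            subst (Every (D C)) (lookup-allPositions (unflatten κ w)) (domainAtoms-sound κ w (allPositions _) typed gs)

          equalityAtoms-sound : {V l : List (Fin (nTy P))} (ν : All (U A) V) (a b : All (_∈ V) l) →
                                All (Sat ν) (equalityAtoms a b) → All.map (All.lookup ν) a ≡ All.map (All.lookup ν) b
          equalityAtoms-sound ν [] [] [] = refl
          equalityAtoms-sound ν (m ∷ a) (m′ ∷ b) (g ∷ gs) = cong₂ _∷_ g (equalityAtoms-sound ν a b gs)

          pair-≡ : {i j : Fin (nTy M)} (e : i ≡ j) {p : U φA i} {q : U φA j} → p ≡ subst (U φA) (sym e) q →
                   _≡_ {A = UC} (i , p) (j , q)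
          pair-≡ refl refl = refl

          translateAtom-sound : {Γ : List (Fin (nTy S))} (κ : Choice Γ) (w : All (U A) (choiceAr κ)) (a : AtomQ Γ) →
                                ChoiceRespects κ a → All (Sat w) (translateAtom κ a) → SQ.Holds (unflatten κ w) a
          translateAtom-sound κ w (relA s as) _ (g ∷ []) =
            subst (SQ.Fact s) (unflatten-blocks κ w as)
              (Equivalence.to (idxArgs⇔ (s , All.map (All.lookup κ) as) w (blocks κ as)) g)
          translateAtom-sound κ w (eqA m₁ m₂) κ≡ gs with All.lookup κ m₁ ≟ All.lookup κ m₂
          ... | yes e =
            trans (lookup-unflatten κ w m₁)
              (trans (pair-≡ e (trans (equalityAtoms-sound w (block κ m₁) _ gs)
                                      (map-subst oT (All.lookup w) (sym e) (block κ m₂))))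
                     (sym (lookup-unflatten κ w m₂)))
          ... | no κ≢ = ⊥-elim (κ≢ κ≡)

          body-sound : {Γ : List (Fin (nTy S))} (κ : Choice Γ) (w : All (U A) (choiceAr κ)) (bs : List (AtomQ Γ)) →
                       All (ChoiceRespects κ) bs → All (Sat w) (cmap (translateAtom κ) bs) →
                       All (SQ.Holds (unflatten κ w)) bs
          body-sound κ w [] [] gs = []
          body-sound κ w (a ∷ bs) (κ≡ ∷ κ≡s) gs =
            translateAtom-sound κ w a κ≡ (proj₁ (++⁻ (translateAtom κ a) gs)) ∷
            body-sound κ w bs κ≡s (proj₂ (++⁻ (translateAtom κ a) gs))

          wellTyped-ar : {ts : List (Fin (nTy S))} (κ : Choice ts) → ts ≡ List.map υ.d (toList κ) → WellTyped κ
          wellTyped-ar [] e = tt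
          wellTyped-ar (i ∷ κ) e = sym (proj₁ (∷-injective e)) , wellTyped-ar κ (proj₂ (∷-injective e))

          outputRule-preserves : Preserves simulation (expand A) Meaning outputRule
          outputRule-preserves w _ (g ∷ []) =
            subst (λ w′ → SQ.Output (unflatten κo (subst (All (U A)) L≡ w′))) (sym (lookup-allPositions w))
              (subst (λ w′ → SQ.Output (unflatten κo w′))
                 (trans (map-subst (λ z → z) (All.lookup w) L≡ (allPositions L))
                        (cong (subst (All (U A)) L≡) (lookup-allPositions w)))
                 (Equivalence.to (idxArgs⇔ (Q.out , κo) w _) g))

          inputRule-preserves : (Sy : Fin (nSym S)) (κ : Choice (ar S Sy)) (R : Fin (nSym M)) → υ.r R ≡ Sy →
                                (e : toList κ ≡ ar M R) → Preserves simulation (expand A) Meaning (inputRule Sy κ R e)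
          inputRule-preserves Sy κ R rR≡Sy e w _ (gR ∷ gs) =
            Equivalence.from (idxArgs⇔ (inj₁ Sy , κ) w (allPositions (choiceAr κ)))
              (subst (λ w′ → SQ.Fact (inj₁ Sy) (unflatten κ w′)) (sym (lookup-allPositions w))
                (SQ.inp (rel-unflatten Sy κ w R rR≡Sy e (unflatten-dom κ w typed gs) out)))
            where
            typed : WellTyped κ
            typed = wellTyped-ar κ (trans (cong (ar S) (sym rR≡Sy)) (trans (υ.arOK R) (cong (List.map υ.d) (sym e))))
            out : Sem.Output (φ.progR R) A (subst (All (U A)) (sym (relAr≡ R κ e)) w)
            out = subst (Sem.Output (φ.progR R) A)
                    (trans (map-subst (λ z → z) (All.lookup w) (sym (relAr≡ R κ e)) (allPositions (choiceAr κ)))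
                           (cong (subst (All (U A)) (sym (relAr≡ R κ e))) (lookup-allPositions w)))
                    (base-sound w (inj₂ R) _ gR)

          simulatedRule-preserves : (r : Rule S Q.nIdb Q.idbAr) → r ∈ Q.rules → (κ : Choice (Rule.vars r)) →
                                    Admissible r κ → Preserves simulation (expand A) Meaning (simulatedRule r κ)
          simulatedRule-preserves r r∈ κ (typed , κ≡s) w _ gs =
            Equivalence.from (idxArgs⇔ (inj₂ (Rule.head r) , All.map (All.lookup κ) (Rule.headArgs r)) w
                                        (blocks κ (Rule.headArgs r)))
              (subst (SQ.Fact (inj₂ (Rule.head r))) (sym (unflatten-blocks κ w (Rule.headArgs r)))
                 (SQ.der r r∈ (unflatten κ w) (unflatten-dom κ w typed (proj₁ split))
                    (body-sound κ w (Rule.body r) κ≡s (proj₂ split))))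
            where
            split : All (Sat w) (domainAtoms κ (allPositions (Rule.vars r))) ×
                    All (Sat w) (cmap (translateAtom κ) (Rule.body r))
            split = ++⁻ (domainAtoms κ (allPositions (Rule.vars r))) gs

          rules-preserve : All (Preserves simulation (expand A) Meaning) (Program.rules simulation)
          rules-preserve = outputRule-preserves ∷ ++⁺
            (All-cmap⁺ (allFin (nSym S)) λ Sy _ → All-cmap⁺ (enumerate (Choice-finite (ar S Sy))) λ κ _ →
               All-cmap⁺ (allFin (nSym M)) λ R _ →
               All-whenDec (υ.r R ≟ Sy) _ λ rR≡Sy → All-whenDec (≡-dec _≟_ (toList κ) (ar M R)) _ λ e →
               inputRule-preserves Sy κ R rR≡Sy e ∷ [])
            (All-cmap⁺ Q.rules λ r r∈ → All-cmap⁺ (enumerate (Choice-finite (Rule.vars r))) λ κ _ →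
               All-whenDec (admissible? r κ) _ λ adm → simulatedRule-preserves r r∈ κ adm ∷ [])

          Derived : (x : Idx) → All (U A) (idxAr x) → Set
          Derived x w = T.Fact (inj₂ (suc (encode Idx-finite x)))
                          (subst (λ z → All (U A) (idxAr z)) (sym (decode-encode Idx-finite x)) w)

          IdxTuple : Set
          IdxTuple = Σ Idx (λ x → All (U A) (idxAr x))

          Derived-≡ : {p q : IdxTuple} → p ≡ q → Derived (proj₁ p) (proj₂ p) → Derived (proj₁ q) (proj₂ q)
          Derived-≡ e = subst (λ p → Derived (proj₁ p) (proj₂ p)) e

          idxArgs-lookup : (x : Idx) {Γ : List (Fin (nTy P))} (ν : All (U A) Γ) (a : All (_∈ Γ) (idxAr x)) →
                           All.map (All.lookup ν) (idxArgs x a) ≡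
                           subst (λ z → All (U A) (idxAr z)) (sym (decode-encode Idx-finite x)) (All.map (All.lookup ν) a)
          idxArgs-lookup x ν a = map-subst idxAr (All.lookup ν) (sym (decode-encode Idx-finite x)) a

          idxAtom-complete : {Γ : List (Fin (nTy P))} (ν : All (U A) Γ) (x : Idx) (a : All (_∈ Γ) (idxAr x)) →
                             Derived x (All.map (All.lookup ν) a) → T.Holds ν (idxAtom x a)
          idxAtom-complete ν x a = subst (T.Fact _) (sym (idxArgs-lookup x ν a))

          idxRule-derives : (x : Idx) {vs : List (Fin (nTy P))} (h : All (_∈ vs) (idxAr x)) (body : List (At vs)) →
                            idxRule x vs h body ∈ Program.rules simulation → (ν : All (U A) vs) → Every (D A) ν →
                            All (T.Holds ν) body → Derived x (All.map (All.lookup ν) h)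
          idxRule-derives x h body r∈ ν dν hs = subst (T.Fact _) (idxArgs-lookup x ν h) (T.der _ r∈ ν dν hs)

          base-complete : {Γ : List (Fin (nTy P))} (ν : All (U A) Γ) (b : Base) (a : All (_∈ Γ) (ar⁺ (inj₂ b))) →
                          Sem.Output (Π b) A (All.map (All.lookup ν) a) → T.Holds ν (expandedAtom (inj₂ b) a)
          base-complete ν b a o = T.inp (Equivalence.from (expandedAtom⇔ A (inj₂ b) ν a) o)

          domainAtoms-complete : {Γ ts : List (Fin (nTy S))} (κ : Choice Γ) (w : All (U A) (choiceAr κ))
                                 (as : All (_∈ Γ) ts) → Every (D C) (All.map (All.lookup (unflatten κ w)) as) →
                                 All (T.Holds w) (domainAtoms κ as)
          domainAtoms-complete κ w [] _ = []
          domainAtoms-complete κ w (m ∷ as) (dc , ds) =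
            base-complete w (inj₁ (All.lookup κ m)) (block κ m) (proj₂ (subst (D C _) (lookup-unflatten κ w m) dc))
            ∷ domainAtoms-complete κ w as ds

          flatOf-domainAtoms : {Γ : List (Fin (nTy S))} (cs : All (U C) Γ) → Every (D C) cs →
                               All (T.Holds (flatOf cs)) (domainAtoms (choiceOf cs) (allPositions Γ))
          flatOf-domainAtoms cs dom = domainAtoms-complete (choiceOf cs) (flatOf cs) (allPositions _)
            (subst (Every (D C)) (sym (lookup-allPositions _)) (subst (Every (D C)) (sym (unflatten-flatOf cs)) dom))

          equalityAtoms-complete : {V l : List (Fin (nTy P))} (ν : All (U A) V) (a b : All (_∈ V) l) →
                                   All.map (All.lookup ν) a ≡ All.map (All.lookup ν) b →
                                   All (T.Holds ν) (equalityAtoms a b)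
          equalityAtoms-complete ν [] [] e = []
          equalityAtoms-complete ν (m ∷ a) (m′ ∷ b) e =
            proj₁ (All-∷-injective e) ∷ equalityAtoms-complete ν a b (proj₂ (All-∷-injective e))

          pair-≡⁻ : {i j : Fin (nTy M)} {p : U φA i} {q : U φA j} → _≡_ {A = UC} (i , p) (j , q) →
                    (e : i ≡ j) → p ≡ subst (U φA) (sym e) q
          pair-≡⁻ refl refl = refl

          Reached : {Γ : List (Fin (nTy S))} → All (U C) Γ → AtomQ Γ → Set
          Reached ν (relA s as) = Derived (s , choiceOf (All.map (All.lookup ν) as)) (flatOf (All.map (All.lookup ν) as))
          Reached ν (eqA m₁ m₂) = All.lookup ν m₁ ≡ All.lookup ν m₂

          flatOf-lookups : {Γ : List (Fin (nTy S))} (ν : All (U C) Γ) (s : Fin (nSym S) ⊎ Fin Q.nIdb)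
                           (as : All (_∈ Γ) (ΔQ s)) →
                           _≡_ {A = IdxTuple}
                               ((s , choiceOf (All.map (All.lookup ν) as)) , flatOf (All.map (All.lookup ν) as))
                                              ((s , All.map (All.lookup (choiceOf ν)) as) ,
                                               All.map (All.lookup (flatOf ν)) (blocks (choiceOf ν) as))
          flatOf-lookups ν s as =
            cong (λ q → (s , proj₁ q) , proj₂ q)
              (unflatten-injective _ _ _ _
                (trans (unflatten-flatOf (All.map (All.lookup ν) as))
                       (sym (trans (unflatten-blocks (choiceOf ν) (flatOf ν) as)
                                   (cong (λ ν → All.map (All.lookup ν) as) (unflatten-flatOf ν))))))

          lookup-flatOf : {Γ : List (Fin (nTy S))} (ν : All (U C) Γ) {t : Fin (nTy S)} (m : t ∈ Γ) →
                          All.lookup ν m ≡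
                          (All.lookup (choiceOf ν) m , All.map (All.lookup (flatOf ν)) (block (choiceOf ν) m))
          lookup-flatOf ν m =
            trans (cong (λ ν → All.lookup ν m) (sym (unflatten-flatOf ν))) (lookup-unflatten (choiceOf ν) (flatOf ν) m)

          translateAtom-complete : {Γ : List (Fin (nTy S))} (ν : All (U C) Γ) (a : AtomQ Γ) →
                                   Reached ν a → All (T.Holds (flatOf ν)) (translateAtom (choiceOf ν) a)
          translateAtom-complete ν (relA s as) h =
            idxAtom-complete (flatOf ν) (s , All.map (All.lookup (choiceOf ν)) as) (blocks (choiceOf ν) as)
              (Derived-≡ (flatOf-lookups ν s as) h) ∷ []
          translateAtom-complete ν (eqA m₁ m₂) h with All.lookup (choiceOf ν) m₁ ≟ All.lookup (choiceOf ν) m₂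
          ... | yes e = equalityAtoms-complete (flatOf ν) (block (choiceOf ν) m₁) _
                          (trans (pair-≡⁻ (trans (sym (lookup-flatOf ν m₁)) (trans h (lookup-flatOf ν m₂))) e)
                                 (sym (map-subst oT (All.lookup (flatOf ν)) (sym e) (block (choiceOf ν) m₂))))
          ... | no _ = []

          body-complete : {Γ : List (Fin (nTy S))} (ν : All (U C) Γ) (bs : List (AtomQ Γ)) →
                          All (Reached ν) bs → All (T.Holds (flatOf ν)) (cmap (translateAtom (choiceOf ν)) bs)
          body-complete ν [] [] = []
          body-complete ν (a ∷ bs) (h ∷ hs) = ++⁺ (translateAtom-complete ν a h) (body-complete ν bs hs)

          choiceOf-respects : {Γ : List (Fin (nTy S))} (ν : All (U C) Γ) (bs : List (AtomQ Γ)) →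
                              All (Reached ν) bs → All (ChoiceRespects (choiceOf ν)) bs
          choiceOf-respects ν [] [] = []
          choiceOf-respects ν (relA s as ∷ bs) (h ∷ hs) = tt ∷ choiceOf-respects ν bs hs
          choiceOf-respects ν (eqA m₁ m₂ ∷ bs) (h ∷ hs) =
            trans (lookup-choiceOf ν m₁) (trans (cong proj₁ h) (sym (lookup-choiceOf ν m₂))) ∷ choiceOf-respects ν bs hs

          choiceOf-wellTyped : {Γ : List (Fin (nTy S))} (ν : All (U C) Γ) → Every (D C) ν → WellTyped (choiceOf ν)
          choiceOf-wellTyped [] _ = tt
          choiceOf-wellTyped (c ∷ ν) ((d , _) , ds) = d , choiceOf-wellTyped ν ds

          input-derived : (Sy : Fin (nSym S)) (cs : All (U C) (ar S Sy)) → rel C Sy cs →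
                          Derived (inj₁ Sy , choiceOf cs) (flatOf cs)
          input-derived Sy cs r with rel-flatOf Sy cs r
          ... | R , rR≡Sy , e , out =
            subst (Derived (inj₁ Sy , κ)) (lookup-allPositions w)
              (idxRule-derives (inj₁ Sy , κ) (allPositions (choiceAr κ)) _ r∈ w (flatOf-dom cs (proj₁ r))
                 (base-complete w (inj₂ R) _ out′ ∷ flatOf-domainAtoms cs (proj₁ r)))
            where
            κ : Choice (ar S Sy)
            κ = choiceOf cs
            w : All (U A) (choiceAr κ)
            w = flatOf cs
            r∈ : inputRule Sy κ R e ∈ Program.rules simulation
            r∈ = there (∈-++⁺ˡ (∈-cmap (allFin (nSym S)) (∈-allFin Sy)
                   (∈-cmap (enumerate (Choice-finite (ar S Sy))) (∈-enumerate (Choice-finite (ar S Sy)) κ)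
                     (∈-cmap (allFin (nSym M)) (∈-allFin R)
                       (∈-whenDec (υ.r R ≟ Sy) _ uip rR≡Sy
                         (∈-whenDec (≡-dec _≟_ (toList κ) (ar M R)) _ uip e (here refl)))))))
            out′ : Sem.Output (φ.progR R) A
                     (All.map (All.lookup w)
                        (subst (All (_∈ choiceAr κ)) (sym (relAr≡ R κ e)) (allPositions (choiceAr κ))))
            out′ = subst (Sem.Output (φ.progR R) A)
                     (sym (trans (map-subst (λ z → z) (All.lookup w) (sym (relAr≡ R κ e)) (allPositions (choiceAr κ)))
                                 (cong (subst (All (U A)) (sym (relAr≡ R κ e))) (lookup-allPositions w))))
                     out

          complete-fact : ∀ {s cs} → SQ.Fact s cs → Derived (s , choiceOf cs) (flatOf cs)
          complete-body : {Γ : List (Fin (nTy S))} (ν : All (U C) Γ) (bs : List (AtomQ Γ)) →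
                          All (SQ.Holds ν) bs → All (Reached ν) bs
          complete-fact {inj₁ Sy} {cs} (SQ.inp r) = input-derived Sy cs r
          complete-fact (SQ.der r r∈ ν dν hs) =
            Derived-≡ (sym (flatOf-lookups ν (inj₂ (Rule.head r)) (Rule.headArgs r)))
              (idxRule-derives (inj₂ (Rule.head r) , All.map (All.lookup κ) (Rule.headArgs r))
                 (blocks κ (Rule.headArgs r)) _ r∈′ (flatOf ν) (flatOf-dom ν dν)
                 (++⁺ (flatOf-domainAtoms ν dν) (body-complete ν (Rule.body r) reached)))
            where
            κ : Choice (Rule.vars r)
            κ = choiceOf ν
            reached : All (Reached ν) (Rule.body r)
            reached = complete-body ν (Rule.body r) hs
            r∈′ : simulatedRule r κ ∈ Program.rules simulation
            r∈′ = there (∈-++⁺ʳ allInputRules (∈-cmap Q.rules r∈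
                    (∈-cmap (enumerate (Choice-finite (Rule.vars r))) (∈-enumerate (Choice-finite (Rule.vars r)) κ)
                      (∈-whenDec-const (admissible? r κ) _
                         (choiceOf-wellTyped ν dν , choiceOf-respects ν (Rule.body r) reached) (here refl)))))
          complete-body ν [] [] = []
          complete-body ν (relA s as ∷ bs) (h ∷ hs) = complete-fact h ∷ complete-body ν bs hs
          complete-body ν (eqA m₁ m₂ ∷ bs) (h ∷ hs) = h ∷ complete-body ν bs hs

          complete : (w : All (U A) L) → SQ.Output (unflatten κo (subst (All (U A)) L≡ w)) → T.Output w
          complete w o =
            subst T.Output (lookup-allPositions w)
              (T.der outputRule (here refl) w dom
                 (idxAtom-complete w (Q.out , κo) _
                    (subst (Derived (Q.out , κo))
                       (sym (trans (map-subst (λ z → z) (All.lookup w) L≡ (allPositions L))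
                                   (cong (subst (All (U A)) L≡) (lookup-allPositions w))))
                       (Derived-≡ (cong (λ q → (Q.out , proj₁ q) , proj₂ q) (flatOf-unflatten κo w′)) (complete-fact o)))
                  ∷ []))
            where
            w′ : All (U A) (choiceAr κo)
            w′ = subst (All (U A)) L≡ w
            dom′ : Every (D A) w′
            dom′ = subst (λ p → Every (D A) (proj₂ p)) (flatOf-unflatten κo w′)
                     (flatOf-dom (unflatten κo w′) (Fact-dom Q C o))
            dom : Every (D A) w
            dom = subst (Every (D A)) (subst-sym-subst L≡) (Every-subst (D A) (sym L≡) dom′)

        simulation-correct : (w : All (U A) L) →
                             Sem.Output simulation (expand A) w ⇔ Sem.Output Q C (unflatten κo (subst (All (U A)) L≡ w))
        simulation-correct w = mk⇔ (Fact-minimal simulation (expand A) Meaning rules-preserve) (complete w)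

  compile : (Q : Program S) (L : List (Fin (nTy P))) (κo : Choice (Program.outAr Q)) → L ≡ choiceAr κo → Program P
  compile Q L κo L≡ = Inline.inlined (Translate.Simulate.simulation Q L κo L≡)

  compile-correct : (Q : Program S) (L : List (Fin (nTy P))) (κo : Choice (Program.outAr Q)) (L≡ : L ≡ choiceAr κo)
                    (A : Structure P) (w : All (U A) L) →
                    Sem.Output (compile Q L κo L≡) A w ⇔
                    Sem.Output Q (Tuples.C A) (Tuples.unflatten A κo (subst (All (U A)) L≡ w))
  compile-correct Q L κo L≡ A w =
    Translate.Simulate.simulation-correct Q L κo L≡ A w ⇔-∘ Inline.inlined-correct _ A w

-- The composed reduction

module Composition {P S T : Signature} (φ : Reduction P S) (χ : Reduction S T) where
  private
    M₂ : Signature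
    M₂ = Reduction.mid χ
    module χI = Interp (Reduction.interp χ)
    module υ₂ = Gadget (Reduction.gadget χ)
    module Sim = Simulation (Reduction.interp φ) (Reduction.gadget φ)
  open Sim using (Choice; Choice-finite; choiceAr; oT; compile; compile-correct)

  oχ : Fin (nTy M₂) → List (Fin (nTy S))
  oχ j = Program.outAr (χI.progT j)

  Choices : List (Fin (nTy M₂)) → Set
  Choices js = All (λ j → Choice (oχ j)) js

  Ty′ : Set
  Ty′ = Σ (Fin (nTy M₂)) (λ j → Choice (oχ j))

  Ty′-finite : Finite Ty′
  Ty′-finite = Finite-Σ (Finite-Fin (nTy M₂)) (λ j → Choice-finite (oχ j))

  Sym′ : Set
  Sym′ = Σ (Fin (nSym M₂)) (λ R → Choices (ar M₂ R))

  Sym′-finite : Finite Sym′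
  Sym′-finite = Finite-Σ (Finite-Fin (nSym M₂)) (λ R → Finite-All _ (λ j → Choice-finite (oχ j)) (ar M₂ R))

  codes : {js : List (Fin (nTy M₂))} → Choices js → List (Fin (size Ty′-finite))
  codes [] = []
  codes {j ∷ js} (κ ∷ κs) = encode Ty′-finite (j , κ) ∷ codes κs

  M′ : Signature
  M′ = record { nTy = size Ty′-finite ; nSym = size Sym′-finite ; ar = λ c → codes (proj₂ (decode Sym′-finite c)) }

  tyAr : Ty′ → List (Fin (nTy P))
  tyAr x = choiceAr (proj₂ x)

  progTy : Ty′ → Program P
  progTy x = compile (χI.progT (proj₁ x)) (tyAr x) (proj₂ x) refl

  symAr : Sym′ → List (Fin (nTy P))
  symAr y = cmap (λ e → tyAr (decode Ty′-finite e)) (codes (proj₂ y))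

  symChoice : (y : Sym′) → Choice (Program.outAr (χI.progR (proj₁ y)))
  symChoice y = subst Choice (sym (χI.arOK (proj₁ y))) (flatten {U = λ _ → Fin _} {a = oχ} (proj₂ y))

  symAr-codes : {js : List (Fin (nTy M₂))} (κs : Choices js) →
                cmap (λ e → tyAr (decode Ty′-finite e)) (codes κs) ≡ cmap oT (concatMapᵗ toList κs)
  symAr-codes [] = refl
  symAr-codes {j ∷ js} (κ ∷ κs) =
    trans (cong₂ _++_ (cong tyAr (decode-encode Ty′-finite (j , κ))) (symAr-codes κs))
          (sym (cmap-++ oT (toList κ) (concatMapᵗ toList κs)))

  symAr≡ : (y : Sym′) → symAr y ≡ choiceAr (symChoice y)
  symAr≡ y = trans (symAr-codes (proj₂ y))
    (cong (cmap oT) (sym (trans (toList-subst (sym (χI.arOK (proj₁ y))) (flatten {U = λ _ → Fin _} {a = oχ} (proj₂ y)))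
                                (toList-flatten {a = oχ} (proj₂ y)))))

  progSym : Sym′ → Program P
  progSym y = compile (χI.progR (proj₁ y)) (symAr y) (symChoice y) (symAr≡ y)

  ψI : Interp P M′
  ψI = record
    { progT = λ e → progTy (decode Ty′-finite e) ; progR = λ c → progSym (decode Sym′-finite c) ; arOK = λ c → refl }

  d′ : Fin (size Ty′-finite) → Fin (nTy T)
  d′ e = υ₂.d (proj₁ (decode Ty′-finite e))

  map-d′-codes : {js : List (Fin (nTy M₂))} (κs : Choices js) → List.map d′ (codes κs) ≡ List.map υ₂.d js
  map-d′-codes [] = refl
  map-d′-codes {j ∷ js} (κ ∷ κs) =
    cong₂ _∷_ (cong (λ x → υ₂.d (proj₁ x)) (decode-encode Ty′-finite (j , κ))) (map-d′-codes κs)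

  υ′ : Gadget M′ T
  υ′ = record
    { d = d′ ; r = λ c → υ₂.r (proj₁ (decode Sym′-finite c))
    ; arOK = λ c → trans (υ₂.arOK (proj₁ (decode Sym′-finite c))) (sym (map-d′-codes (proj₂ (decode Sym′-finite c)))) }

  ψ : Reduction P T
  ψ = record { mid = M′ ; interp = ψI ; gadget = υ′ }

  module _ (A : Structure P) where
    open Sim.Tuples A

    ψA : Structure M′
    ψA = applyI ψI A

    χC : Structure M₂
    χC = applyI (Reduction.interp χ) C

    Elemψ : Set
    Elemψ = Σ (Fin (size Ty′-finite)) (U ψA)

    Elemχφ : Set
    Elemχφ = Σ (Fin (nTy M₂)) (U χC)

    element : (x : Ty′) → All (U A) (tyAr x) → Elemχφ
    element x w = proj₁ x , unflatten (proj₂ x) w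

    forth : Elemψ → Elemχφ
    forth p = element (decode Ty′-finite (proj₁ p)) (proj₂ p)

    Inχφ : Elemχφ → Set
    Inχφ p = D χC (proj₁ p) (proj₂ p)

    ty-correct : (x : Ty′) (w : All (U A) (tyAr x)) → Sem.Output (progTy x) A w ⇔ Inχφ (element x w)
    ty-correct x = compile-correct (χI.progT (proj₁ x)) (tyAr x) (proj₂ x) refl A

    sym-correct : (y : Sym′) (w : All (U A) (symAr y)) →
                  Sem.Output (progSym y) A w ⇔
                  Sem.Output (χI.progR (proj₁ y)) C (unflatten (symChoice y) (subst (All (U A)) (symAr≡ y) w))
    sym-correct y = compile-correct (χI.progR (proj₁ y)) (symAr y) (symChoice y) (symAr≡ y) A

    element-subst : {y x : Ty′} (e : y ≡ x) (w : All (U A) (tyAr x)) →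
                element y (subst (λ z → All (U A) (tyAr z)) (sym e) w) ≡ element x w
    element-subst e w = dcong₂ element e (subst-subst-sym e)

    element-subst′ : {y x : Ty′} (e : y ≡ x) (w : All (U A) (tyAr y)) →
                 element y w ≡ element x (subst (λ z → All (U A) (tyAr z)) e w)
    element-subst′ e w = dcong₂ element e refl

    tyOf : Elemχφ → Ty′
    tyOf p = proj₁ p , choiceOf (proj₂ p)

    tyOf-element : (x : Ty′) (w : All (U A) (tyAr x)) → tyOf (element x w) ≡ x
    tyOf-element x w = cong (proj₁ x ,_) (cong proj₁ (flatOf-unflatten (proj₂ x) w))

    forth-injective : (p q : Elemψ) → forth p ≡ forth q → p ≡ q
    forth-injective (e , w) (e′ , w′) eq
      with decode-injective Ty′-finite (trans (sym (tyOf-element _ w)) (trans (cong tyOf eq) (tyOf-element _ w′)))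
    ... | refl = cong (e ,_) (,-injectiveʳ (unflatten-injective _ _ w w′ (,-injectiveʳ eq)))

    back : Elemχφ → Elemψ
    back (j , cs) = encode Ty′-finite (j , choiceOf cs) ,
                     subst (λ x → All (U A) (tyAr x)) (sym (decode-encode Ty′-finite (j , choiceOf cs))) (flatOf cs)

    forth-back : (q : Elemχφ) → forth (back q) ≡ q
    forth-back (j , cs) =
      trans (element-subst (decode-encode Ty′-finite (j , choiceOf cs)) (flatOf cs)) (cong (j ,_) (unflatten-flatOf cs))

    choicesOf : {ts : List (Fin (nTy S))} → All (U C) ts → List (Fin (nTy (Reduction.mid φ)))
    choicesOf cs = toList (choiceOf cs)

    entriesOf : {ts : List (Fin (nTy S))} → All (U C) ts → List (Σ (Fin (nTy P)) (U A))
    entriesOf cs = tag (flatOf cs)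

    ≡-from-choices-entries : {ts : List (Fin (nTy S))} (cs cs′ : All (U C) ts) →
                             choicesOf cs ≡ choicesOf cs′ → entriesOf cs ≡ entriesOf cs′ → cs ≡ cs′
    ≡-from-choices-entries [] [] _ _ = refl
    ≡-from-choices-entries ((i , p) ∷ cs) ((i′ , p′) ∷ cs′) e₁ e₂ with proj₁ (∷-injective e₁)
    ... | refl =
      cong₂ _∷_ (cong (i ,_) (proj₁ split)) (≡-from-choices-entries cs cs′ (proj₂ (∷-injective e₁)) (proj₂ split))
      where
      split : p ≡ p′ × entriesOf cs ≡ entriesOf cs′
      split = tag-cancelˡ p p′ (trans (sym (tag-++ᵗ p (flatOf cs))) (trans e₂ (tag-++ᵗ p′ (flatOf cs′))))

    choicesOf-++ᵗ : {xs ys : List (Fin (nTy S))} (a : All (U C) xs) (b : All (U C) ys) →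
                    choicesOf (a ++ᵗ b) ≡ choicesOf a ++ choicesOf b
    choicesOf-++ᵗ [] b = refl
    choicesOf-++ᵗ (c ∷ a) b = cong (_ ∷_) (choicesOf-++ᵗ a b)

    entriesOf-++ᵗ : {xs ys : List (Fin (nTy S))} (a : All (U C) xs) (b : All (U C) ys) →
                    entriesOf (a ++ᵗ b) ≡ entriesOf a ++ entriesOf b
    entriesOf-++ᵗ [] b = refl
    entriesOf-++ᵗ ((i , p) ∷ a) b =
      trans (tag-++ᵗ p (flatOf (a ++ᵗ b)))
        (trans (cong (tag p ++_) (entriesOf-++ᵗ a b))
          (trans (sym (++-assoc (tag p) (entriesOf a) (entriesOf b)))
                 (cong (_++ entriesOf b) (sym (tag-++ᵗ p (flatOf a))))))

    choicesOf-subst : {xs ys : List (Fin (nTy S))} (e : xs ≡ ys) (a : All (U C) xs) →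
                      choicesOf (subst (All (λ _ → UC)) e a) ≡ choicesOf a
    choicesOf-subst refl a = refl

    entriesOf-subst : {xs ys : List (Fin (nTy S))} (e : xs ≡ ys) (a : All (U C) xs) →
                      entriesOf (subst (All (λ _ → UC)) e a) ≡ entriesOf a
    entriesOf-subst refl a = refl

    choicesOf-flatten : {js : List (Fin (nTy M₂))} (ys : All (U χC) js) →
                        choicesOf (flatten {U = λ _ → UC} {a = oχ} ys) ≡ concatMapᵗ choicesOf ys
    choicesOf-flatten [] = refl
    choicesOf-flatten (y ∷ ys) =
      trans (choicesOf-++ᵗ y (flatten {U = λ _ → UC} {a = oχ} ys)) (cong (choicesOf y ++_) (choicesOf-flatten ys))

    entriesOf-flatten : {js : List (Fin (nTy M₂))} (ys : All (U χC) js) →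
                        entriesOf (flatten {U = λ _ → UC} {a = oχ} ys) ≡ concatMapᵗ entriesOf ys
    entriesOf-flatten [] = refl
    entriesOf-flatten (y ∷ ys) =
      trans (entriesOf-++ᵗ y (flatten {U = λ _ → UC} {a = oχ} ys)) (cong (entriesOf y ++_) (entriesOf-flatten ys))

    choicesOf-unflatten : {ts : List (Fin (nTy S))} (κ : Choice ts) (w : All (U A) (choiceAr κ)) →
                          choicesOf (unflatten κ w) ≡ toList κ
    choicesOf-unflatten κ w = cong (λ q → toList (proj₁ q)) (flatOf-unflatten κ w)

    entriesOf-unflatten : {ts : List (Fin (nTy S))} (κ : Choice ts) (w : All (U A) (choiceAr κ)) →
                          entriesOf (unflatten κ w) ≡ tag w
    entriesOf-unflatten κ w = cong (λ q → tag (proj₂ q)) (flatOf-unflatten κ w)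

    decodeᵗ : (x : Ty′) → U ψA (encode Ty′-finite x) → All (U A) (tyAr x)
    decodeᵗ x w = subst (λ y → All (U A) (tyAr y)) (decode-encode Ty′-finite x) w

    Corresponds : {js : List (Fin (nTy M₂))} (κs : Choices js) → All (U ψA) (codes κs) →
                  All (U χC) js → Set
    Corresponds [] [] [] = ⊤
    Corresponds {j ∷ js} (κ ∷ κs) (x ∷ xs) (y ∷ ys) = y ≡ unflatten κ (decodeᵗ (j , κ) x) × Corresponds κs xs ys

    corresponds-lists : {js : List (Fin (nTy M₂))} (κs : Choices js) (xs : All (U ψA) (codes κs))
                        (ys : All (U χC) js) → Corresponds κs xs ys →
                        (concatMapᵗ choicesOf ys ≡ concatMapᵗ toList κs) × (concatMapᵗ entriesOf ys ≡ concatMapᵗ tag xs)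
    corresponds-lists [] [] [] _ = refl , refl
    corresponds-lists {j ∷ js} (κ ∷ κs) (x ∷ xs) (y ∷ ys) (refl , c) =
      cong₂ _++_ (choicesOf-unflatten κ (decodeᵗ (j , κ) x)) (proj₁ (corresponds-lists κs xs ys c)) ,
      cong₂ _++_ (trans (entriesOf-unflatten κ (decodeᵗ (j , κ) x)) (tag-subst tyAr (decode-encode Ty′-finite (j , κ)) x))
                 (proj₂ (corresponds-lists κs xs ys c))

    corresponds-flatten : (y : Sym′) (xs : All (U ψA) (codes (proj₂ y))) (ys : All (U χC) (ar M₂ (proj₁ y))) →
                          Corresponds (proj₂ y) xs ys →
                          unflatten (symChoice y)
                            (subst (All (U A)) (symAr≡ y) (flatten {U = U A} {a = λ e → tyAr (decode Ty′-finite e)} xs)) ≡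
                          subst (All (λ _ → UC)) (sym (χI.arOK (proj₁ y))) (flatten {U = λ _ → UC} {a = oχ} ys)
    corresponds-flatten y xs ys c = ≡-from-choices-entries _ _
      (trans (choicesOf-unflatten (symChoice y) _)
        (trans (toList-subst (sym (χI.arOK (proj₁ y))) (flatten {U = λ _ → Fin _} {a = oχ} (proj₂ y)))
          (trans (toList-flatten {a = oχ} (proj₂ y))
            (sym (trans (choicesOf-subst (sym (χI.arOK (proj₁ y))) _)
                   (trans (choicesOf-flatten ys) (proj₁ (corresponds-lists (proj₂ y) xs ys c))))))))
      (trans (entriesOf-unflatten (symChoice y) _)
        (trans (tag-subst (λ z → z) (symAr≡ y) (flatten {U = U A} {a = λ e → tyAr (decode Ty′-finite e)} xs))
          (trans (tag-flatten {a = λ e → tyAr (decode Ty′-finite e)} xs)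
            (sym (trans (entriesOf-subst (sym (χI.arOK (proj₁ y))) _)
                   (trans (entriesOf-flatten ys) (proj₂ (corresponds-lists (proj₂ y) xs ys c))))))))

    corresponds-tag : {js : List (Fin (nTy M₂))} (κs : Choices js) (xs : All (U ψA) (codes κs))
                      (ys : All (U χC) js) → Corresponds κs xs ys → List.map forth (tag xs) ≡ tag ys
    corresponds-tag [] [] [] _ = refl
    corresponds-tag {j ∷ js} (κ ∷ κs) (x ∷ xs) (y ∷ ys) (refl , c) =
      cong₂ _∷_ (element-subst′ (decode-encode Ty′-finite (j , κ)) x) (corresponds-tag κs xs ys c)

    unflattens : {js : List (Fin (nTy M₂))} (κs : Choices js) → All (U ψA) (codes κs) → All (U χC) js
    unflattens [] [] = []
    unflattens {j ∷ js} (κ ∷ κs) (x ∷ xs) = unflatten κ (decodeᵗ (j , κ) x) ∷ unflattens κs xs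

    corresponds-unflattens : {js : List (Fin (nTy M₂))} (κs : Choices js) (xs : All (U ψA) (codes κs)) →
                             Corresponds κs xs (unflattens κs xs)
    corresponds-unflattens [] [] = tt
    corresponds-unflattens (κ ∷ κs) (x ∷ xs) = refl , corresponds-unflattens κs xs

    unflattens-dom : {js : List (Fin (nTy M₂))} (κs : Choices js) (xs : All (U ψA) (codes κs)) →
                     Every (D ψA) xs → Every (D χC) (unflattens κs xs)
    unflattens-dom [] [] _ = tt
    unflattens-dom {j ∷ js} (κ ∷ κs) (x ∷ xs) (d , ds) =
      subst Inχφ (element-subst′ (decode-encode Ty′-finite (j , κ)) x)
        (Equivalence.to (ty-correct (decode Ty′-finite (encode Ty′-finite (j , κ))) x) d)
      , unflattens-dom κs xs ds

    flatOfs : {js : List (Fin (nTy M₂))} (ys : All (U χC) js) → All (U ψA) (codes (All.map choiceOf ys))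
    flatOfs [] = []
    flatOfs {j ∷ js} (y ∷ ys) = proj₂ (back (j , y)) ∷ flatOfs ys

    corresponds-flatOfs : {js : List (Fin (nTy M₂))} (ys : All (U χC) js) →
                          Corresponds (All.map choiceOf ys) (flatOfs ys) ys
    corresponds-flatOfs [] = tt
    corresponds-flatOfs {j ∷ js} (y ∷ ys) =
      sym (trans (cong (unflatten (choiceOf y)) (subst-subst-sym (decode-encode Ty′-finite (j , choiceOf y))))
                 (unflatten-flatOf y))
      , corresponds-flatOfs ys

    flatOfs-dom : {js : List (Fin (nTy M₂))} (ys : All (U χC) js) →
                  Every (D χC) ys → Every (D ψA) (flatOfs ys)
    flatOfs-dom [] _ = tt
    flatOfs-dom {j ∷ js} (y ∷ ys) (d , ds) =
      Equivalence.from (ty-correct (decode Ty′-finite (proj₁ (back (j , y)))) _)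
        (subst Inχφ (sym (forth-back (j , y))) d)
      , flatOfs-dom ys ds

    private
      presD : ∀ t (p : Elemψ) → D (applyR ψ A) t p → D (applyR χ C) t (forth p)
      presD t p d = proj₁ d , Equivalence.to (ty-correct (decode Ty′-finite (proj₁ p)) (proj₂ p)) (proj₂ d)

      surj : ∀ t (q : Elemχφ) → D (applyR χ C) t q → Σ[ p ∈ Elemψ ] (D (applyR ψ A) t p × forth p ≡ q)
      surj t (j , cs) (dj , o) =
        back (j , cs) ,
        (trans (cong (λ x → υ₂.d (proj₁ x)) (decode-encode Ty′-finite (j , choiceOf cs))) dj ,
         Equivalence.from (ty-correct _ _) (subst Inχφ (sym (forth-back (j , cs))) o)) ,
        forth-back (j , cs)

      presRel : ∀ Sy (ws : All (λ _ → Elemψ) (ar T Sy)) → Every (D (applyR ψ A)) ws →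
                rel (applyR ψ A) Sy ws → rel (applyR χ C) Sy (All.map forth ws)
      presRel Sy ws dws (_ , c , rc≡Sy , xs , (dxs , out) , ws≡xs) =
        Every-map (D (applyR ψ A)) (D (applyR χ C)) forth presD ws dws ,
        proj₁ y , rc≡Sy , ys ,
        (unflattens-dom (proj₂ y) xs dxs ,
         subst (Sem.Output (χI.progR (proj₁ y)) C) (corresponds-flatten y xs ys corr)
           (Equivalence.to (sym-correct y _) out)) ,
        trans (toList-map forth ws) (trans (cong (List.map forth) ws≡xs) (corresponds-tag (proj₂ y) xs ys corr))
        where
        y : Sym′
        y = decode Sym′-finite c
        ys : All (U χC) (ar M₂ (proj₁ y))
        ys = unflattens (proj₂ y) xs
        corr : Corresponds (proj₂ y) xs ys
        corr = corresponds-unflattens (proj₂ y) xs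

      reflRel : ∀ Sy (ws : All (λ _ → Elemψ) (ar T Sy)) → Every (D (applyR ψ A)) ws →
                rel (applyR χ C) Sy (All.map forth ws) → rel (applyR ψ A) Sy ws
      reflRel Sy ws dws (_ , R , rR≡Sy , ys , (dys , o) , ws≡ys) =
        dws , encode Sym′-finite y , proj₁ (proj₂ w) , proj₁ w , proj₂ (proj₂ w)
        where
        y : Sym′
        y = R , All.map choiceOf ys
        Witness : Sym′ → Set
        Witness y = Σ[ xs ∈ All (U ψA) (codes (proj₂ y)) ] (υ₂.r (proj₁ y) ≡ Sy ×
                      ((Every (D ψA) xs × Sem.Output (progSym y) A (flatten xs)) × toList ws ≡ tag xs))
        corr : Corresponds (proj₂ y) (flatOfs ys) ys
        corr = corresponds-flatOfs ys
        w : Witness (decode Sym′-finite (encode Sym′-finite y))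
        w = subst Witness (sym (decode-encode Sym′-finite y))
              (flatOfs ys , rR≡Sy ,
               (flatOfs-dom ys dys ,
                Equivalence.from (sym-correct y _)
                  (subst (Sem.Output (χI.progR R) C) (sym (corresponds-flatten y (flatOfs ys) ys corr)) o)) ,
               map-injective (λ {p} {q} → forth-injective p q)
                 (trans (sym (toList-map forth ws))
                        (trans ws≡ys (sym (corresponds-tag (proj₂ y) (flatOfs ys) ys corr)))))

    composition-iso : Iso (applyR ψ A) (applyR χ C)
    composition-iso = record
      { f = λ _ → forth ; presD = presD ; inj = λ _ p q _ _ → forth-injective p q ; surj = surj
      ; presRel = λ Sy ws dws → mk⇔ (presRel Sy ws dws) (reflRel Sy ws dws) }

theorem3p7 : (P S T : Signature) (φ : Reduction P S) (χ : Reduction S T) →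
             Σ[ ψ ∈ Reduction P T ]
               ((A : Structure P) → Iso (applyR ψ A) (applyR χ (applyR φ A)))
theorem3p7 P S T φ χ = Composition.ψ φ χ , Composition.composition-iso φ χ
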